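{- (Syntactic minimal invariance.) Let $\tau=\mu\alpha.(\mathsf{nat}+(\alpha\to\alpha))$, $\mathit{id}=\lambda x.x$, and $f=\lambda h.\lambda x.\,\mathsf{case}\,x\,\mathsf{of}\,(\mathsf{in}_1\,y\Rightarrow \mathsf{in}_1\,y\mid \mathsf{in}_2\,g\Rightarrow \mathsf{in}_2\,(\lambda y.\,h(g(h\,y))))$, a closed value of type $(\tau\to\tau)\to(\tau\to\tau)$. Then $\emptyset;\emptyset\vdash\mathsf{fix}[\tau][\tau]\,f\cong^{ctx}\mathit{id}:\tau\to\tau$.
   Context: Language. Types: $\tau ::= \alpha \mid \mathbf{1} \mid \tau_1\times\tau_2 \mid \tau_1\to\tau_2 \mid \mu\alpha.(\tau_1+\dots+\tau_n) \mid \forall\alpha.\tau$. Values: $v ::= x \mid \langle\rangle \mid \langle v_1,v_2\rangle \mid \lambda x.e \mid \mathsf{in}_i\,v \mid \Lambda\alpha.e$. Terms: $e ::= v \mid ? \mid \mathsf{proj}_i\,v \mid v\,e \mid \mathsf{case}\,v\,\mathsf{of}\,(\mathsf{in}_1 x_1\Rightarrow e_1\mid\dots\mid \mathsf{in}_n x_n\Rightarrow e_n) \mid v[\tau]$. Evaluation contexts $E ::= [\,]\mid v\,E$. Reduction $\mapsto$: $\mathsf{proj}_i\langle v_1,v_2\rangle\mapsto v_i$; $(\lambda x.e)\,v\mapsto e[v/x]$; $(\Lambda\alpha.e)[\tau]\mapsto e[\tau/\alpha]$; $\mathsf{case}\,(\mathsf{in}_j v)\,\mathsf{of}(\dots\mid\mathsf{in}_j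 x_j\Rightarrow e_j\mid\dots)\mapsto e_j[v/x_j]$; $?\mapsto\underline n$ for each $n\in\mathbb N$ ($\mathsf{nat}=\mu\alpha.(\mathbf 1+\alpha)$, $\underline 0=\mathsf{in}_1\langle\rangle$, $\underline{n+1}=\mathsf{in}_2\underline n$); $v\,e\mapsto v\,e'$ if $e\mapsto e'$. Typing is the standard one for this call-by-value polymorphic lambda calculus with iso-recursive sums and $?:\mathsf{nat}$. In $f$, a nested application such as $h(g(h\,y))$ is well-formed since applications $v\,e$ have a value in function position. $\mathsf{let}\,x=e\,\mathsf{in}\,e'$ abbreviates $(\lambda x.e')\,e$. The fixed point combinator: $\mathsf{fix}=\Lambda\alpha.\Lambda\beta.\lambda f.\,\delta_f\,(\mathsf{in}\,\delta_f)$, where $\delta_f=\lambda y.\,\mathsf{case}\,y\,\mathsf{of}\,(\mathsf{in}\,y'\Rightarrow f(\lambda x.\,\mathsf{let}\,r=y'\,y\,\mathsf{in}\,r\,x))$ and $\mathsf{in}$ is the injection into the one-summand recursive type $\mu\gamma.(\gamma\to(\alpha\to\beta))$. $\mathsf{fix}[\tau][\tau]\,f$ abbreviates $\mathsf{let}\,x=\mathsf{fix}[\tau]\,\mathsf{in}\,\mathsf{let}\,y=x[\tau]\,\mathsf{in}\,y\,f$. Observables: $e\downarrow$ if $e\mapsto^*v$ for some value $v$; $e\Downarrow$ if there is no infinite reduction sequence from $e$. A type-indexed relation is a set of tuples $(\Delta,\Gamma,e,e',\tau)$ with $e,e'$ both of type $\tau$ in $\Delta;\Gamma$; it is compatible if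 it relates each variable to itself, $\langle\rangle$ to $\langle\rangle$, $?$ to $?$, and relates terms built by the same constructor from related immediate subterms; a precongruence is a reflexive, transitive, compatible one; it is may- (must-) adequate if whenever it relates closed $e,e'$, $e\downarrow\Rightarrow e'\downarrow$ (resp. $e\Downarrow\Rightarrow e'\Downarrow$). $\lesssim^{ctx}_{\downarrow}$ ($\lesssim^{ctx}_{\Downarrow}$) is the largest may- (must-) adequate precongruence. Contextual equivalence $\cong^{ctx}$ relates $e,e'$ iff each of $e\lesssim^{ctx}_{\downarrow}e'$, $e'\lesssim^{ctx}_{\downarrow}e$, $e\lesssim^{ctx}_{\Downarrow}e'$, $e'\lesssim^{ctx}_{\Downarrow}e$ holds. -}

module Defs where

open import Data.Nat using (ℕ; zero; suc)
open import Data.Fin using (Fin; zero; suc)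
open import Data.List using (List; []; _∷_)
open import Data.Vec using (Vec; lookup) renaming ([] to []ᵥ; _∷_ to _∷ᵥ_; map to mapᵥ)
open import Data.Product using (Σ; _×_; _,_)
open import Data.Empty using (⊥)
open import Relation.Binary.PropositionalEquality using (_≡_)
open import Relation.Nullary using (¬_)

-- Types (de Bruijn; Ty n = types with n free type variables)
-- μ τ τs  stands for  μα.(τ + τs₁ + … + τsₖ)  (at least one summand)

data Ty (n : ℕ) : Set where
  `_   : Fin n → Ty n
  𝟙    : Ty n
  _⊗_  : Ty n → Ty n → Ty n
  _⇒_  : Ty n → Ty n → Ty n
  μ    : Ty (suc n) → List (Ty (suc n)) → Ty n
  ∀'   : Ty (suc n) → Ty n

infixr 7 _⇒_
infixr 8 _⊗_

extR : ∀ {n k} → (Fin n → Fin k) → Fin (suc n) → Fin (suc k)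
extR ρ zero    = zero
extR ρ (suc i) = suc (ρ i)

mutual
  renT : ∀ {n k} → (Fin n → Fin k) → Ty n → Ty k
  renT ρ (` i)    = ` ρ i
  renT ρ 𝟙        = 𝟙
  renT ρ (a ⊗ b)  = renT ρ a ⊗ renT ρ b
  renT ρ (a ⇒ b)  = renT ρ a ⇒ renT ρ b
  renT ρ (μ a as) = μ (renT (extR ρ) a) (renTs (extR ρ) as)
  renT ρ (∀' a)   = ∀' (renT (extR ρ) a)

  renTs : ∀ {n k} → (Fin n → Fin k) → List (Ty n) → List (Ty k)
  renTs ρ []       = []
  renTs ρ (a ∷ as) = renT ρ a ∷ renTs ρ as

extS : ∀ {n k} → (Fin n → Ty k) → Fin (suc n) → Ty (suc k)
extS σ zero    = ` zero
extS σ (suc i) = renT suc (σ i)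

mutual
  subT : ∀ {n k} → (Fin n → Ty k) → Ty n → Ty k
  subT σ (` i)    = σ i
  subT σ 𝟙        = 𝟙
  subT σ (a ⊗ b)  = subT σ a ⊗ subT σ b
  subT σ (a ⇒ b)  = subT σ a ⇒ subT σ b
  subT σ (μ a as) = μ (subT (extS σ) a) (subTs (extS σ) as)
  subT σ (∀' a)   = ∀' (subT (extS σ) a)

  subTs : ∀ {n k} → (Fin n → Ty k) → List (Ty n) → List (Ty k)
  subTs σ []       = []
  subTs σ (a ∷ as) = subT σ a ∷ subTs σ as

_[_]T : ∀ {n} → Ty (suc n) → Ty n → Ty n
τ [ σ ]T = subT s τ
  where
  s : _ → _
  s zero    = σ
  s (suc i) = ` i

-- nat = μα.(1 + α)
nat : ∀ {n} → Ty n
nat = μ 𝟙 ((` zero) ∷ [])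

-- position lookup in a list (0-based)
data Nth {A : Set} : List A → ℕ → A → Set where
  here  : ∀ {x xs} → Nth (x ∷ xs) zero x
  there : ∀ {x y xs i} → Nth xs i y → Nth (x ∷ xs) (suc i) y

-- Values and terms: d free type variables, m free term variables.
-- inj i v  is  in_{i+1} v  (0-based injection index).

mutual
  data Val (d m : ℕ) : Set where
    var  : Fin m → Val d m
    unit : Val d m
    pair : Val d m → Val d m → Val d m
    lam  : Tm d (suc m) → Val d m
    inj  : ℕ → Val d m → Val d m
    tlam : Tm (suc d) m → Val d m

  data Tm (d m : ℕ) : Set where
    val   : Val d m → Tm d m
    ??    : Tm d m
    projL : Val d m → Tm d m
    projR : Val d m → Tm d m
    app   : Val d m → Tm d m → Tm d m
    case  : Val d m → List (Tm d (suc m)) → Tm d m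
    tapp  : Val d m → Ty d → Tm d m

mutual
  renV : ∀ {d m k} → (Fin m → Fin k) → Val d m → Val d k
  renV ρ (var i)    = var (ρ i)
  renV ρ unit       = unit
  renV ρ (pair v w) = pair (renV ρ v) (renV ρ w)
  renV ρ (lam e)    = lam (renTm (extR ρ) e)
  renV ρ (inj i v)  = inj i (renV ρ v)
  renV ρ (tlam e)   = tlam (renTm ρ e)

  renTm : ∀ {d m k} → (Fin m → Fin k) → Tm d m → Tm d k
  renTm ρ (val v)     = val (renV ρ v)
  renTm ρ ??          = ??
  renTm ρ (projL v)   = projL (renV ρ v)
  renTm ρ (projR v)   = projR (renV ρ v)
  renTm ρ (app v e)   = app (renV ρ v) (renTm ρ e)
  renTm ρ (case v bs) = case (renV ρ v) (renBs (extR ρ) bs)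
  renTm ρ (tapp v τ)  = tapp (renV ρ v) τ

  renBs : ∀ {d m k} → (Fin m → Fin k) → List (Tm d m) → List (Tm d k)
  renBs ρ []       = []
  renBs ρ (e ∷ es) = renTm ρ e ∷ renBs ρ es

mutual
  tyRenV : ∀ {d d' m} → (Fin d → Fin d') → Val d m → Val d' m
  tyRenV ρ (var i)    = var i
  tyRenV ρ unit       = unit
  tyRenV ρ (pair v w) = pair (tyRenV ρ v) (tyRenV ρ w)
  tyRenV ρ (lam e)    = lam (tyRenTm ρ e)
  tyRenV ρ (inj i v)  = inj i (tyRenV ρ v)
  tyRenV ρ (tlam e)   = tlam (tyRenTm (extR ρ) e)

  tyRenTm : ∀ {d d' m} → (Fin d → Fin d') → Tm d m → Tm d' m
  tyRenTm ρ (val v)     = val (tyRenV ρ v)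
  tyRenTm ρ ??          = ??
  tyRenTm ρ (projL v)   = projL (tyRenV ρ v)
  tyRenTm ρ (projR v)   = projR (tyRenV ρ v)
  tyRenTm ρ (app v e)   = app (tyRenV ρ v) (tyRenTm ρ e)
  tyRenTm ρ (case v bs) = case (tyRenV ρ v) (tyRenBs ρ bs)
  tyRenTm ρ (tapp v τ)  = tapp (tyRenV ρ v) (renT ρ τ)

  tyRenBs : ∀ {d d' m} → (Fin d → Fin d') → List (Tm d m) → List (Tm d' m)
  tyRenBs ρ []       = []
  tyRenBs ρ (e ∷ es) = tyRenTm ρ e ∷ tyRenBs ρ es

extsV : ∀ {d m k} → (Fin m → Val d k) → Fin (suc m) → Val d (suc k)
extsV σ zero    = var zero
extsV σ (suc i) = renV suc (σ i)

mutual
  subV : ∀ {d m k} → (Fin m → Val d k) → Val d m → Val d k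
  subV σ (var i)    = σ i
  subV σ unit       = unit
  subV σ (pair v w) = pair (subV σ v) (subV σ w)
  subV σ (lam e)    = lam (subTm (extsV σ) e)
  subV σ (inj i v)  = inj i (subV σ v)
  subV σ (tlam e)   = tlam (subTm (λ i → tyRenV suc (σ i)) e)

  subTm : ∀ {d m k} → (Fin m → Val d k) → Tm d m → Tm d k
  subTm σ (val v)     = val (subV σ v)
  subTm σ ??          = ??
  subTm σ (projL v)   = projL (subV σ v)
  subTm σ (projR v)   = projR (subV σ v)
  subTm σ (app v e)   = app (subV σ v) (subTm σ e)
  subTm σ (case v bs) = case (subV σ v) (subBs (extsV σ) bs)
  subTm σ (tapp v τ)  = tapp (subV σ v) τ

  subBs : ∀ {d m k} → (Fin m → Val d k) → List (Tm d m) → List (Tm d k)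
  subBs σ []       = []
  subBs σ (e ∷ es) = subTm σ e ∷ subBs σ es

mutual
  tsubV : ∀ {d d' m} → (Fin d → Ty d') → Val d m → Val d' m
  tsubV σ (var i)    = var i
  tsubV σ unit       = unit
  tsubV σ (pair v w) = pair (tsubV σ v) (tsubV σ w)
  tsubV σ (lam e)    = lam (tsubTm σ e)
  tsubV σ (inj i v)  = inj i (tsubV σ v)
  tsubV σ (tlam e)   = tlam (tsubTm (extS σ) e)

  tsubTm : ∀ {d d' m} → (Fin d → Ty d') → Tm d m → Tm d' m
  tsubTm σ (val v)     = val (tsubV σ v)
  tsubTm σ ??          = ??
  tsubTm σ (projL v)   = projL (tsubV σ v)
  tsubTm σ (projR v)   = projR (tsubV σ v)
  tsubTm σ (app v e)   = app (tsubV σ v) (tsubTm σ e)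
  tsubTm σ (case v bs) = case (tsubV σ v) (tsubBs σ bs)
  tsubTm σ (tapp v τ)  = tapp (tsubV σ v) (subT σ τ)

  tsubBs : ∀ {d d' m} → (Fin d → Ty d') → List (Tm d m) → List (Tm d' m)
  tsubBs σ []       = []
  tsubBs σ (e ∷ es) = tsubTm σ e ∷ tsubBs σ es

_[_]v : ∀ {d m} → Tm d (suc m) → Val d m → Tm d m
e [ v ]v = subTm s e
  where
  s : Fin (suc _) → Val _ _
  s zero    = v
  s (suc i) = var i

_[_]t : ∀ {d m} → Tm (suc d) m → Ty d → Tm d m
e [ τ ]t = tsubTm s e
  where
  s : Fin (suc _) → Ty _
  s zero    = τ
  s (suc i) = ` i

num : ∀ {d m} → ℕ → Val d m
num zero    = inj zero unit
num (suc n) = inj (suc zero) (num n)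

data _↦_ {d m : ℕ} : Tm d m → Tm d m → Set where
  β-projL : ∀ {v w} → projL (pair v w) ↦ val v
  β-projR : ∀ {v w} → projR (pair v w) ↦ val w
  β-lam   : ∀ {e v} → app (lam e) (val v) ↦ (e [ v ]v)
  β-tlam  : ∀ {e τ} → tapp (tlam e) τ ↦ (e [ τ ]t)
  β-case  : ∀ {j v bs e} → Nth bs j e → case (inj j v) bs ↦ (e [ v ]v)
  β-?     : (n : ℕ) → ?? ↦ val (num n)
  ξ-app   : ∀ {v e e'} → e ↦ e' → app v e ↦ app v e'

data _↦*_ {d m : ℕ} : Tm d m → Tm d m → Set where
  done : ∀ {e} → e ↦* e
  step : ∀ {e e' e''} → e ↦ e' → e' ↦* e'' → e ↦* e''

_↓ : Tm 0 0 → Set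
e ↓ = Σ (Val 0 0) λ v → e ↦* val v

_⇓ : Tm 0 0 → Set
e ⇓ = ¬ (Σ (ℕ → Tm 0 0) λ s → (s zero ≡ e) × (∀ n → s n ↦ s (suc n)))

-- Typing  Δ;Γ ⊢ e : τ   (Δ = d type variables, Γ : Vec (Ty d) m)

Ctx : ℕ → ℕ → Set
Ctx d m = Vec (Ty d) m

wkCtx : ∀ {d m} → Ctx d m → Ctx (suc d) m
wkCtx Γ = mapᵥ (renT suc) Γ

mutual
  data _⊢v_∶_ {d m : ℕ} (Γ : Ctx d m) : Val d m → Ty d → Set where
    ⊢var  : (i : Fin m) → Γ ⊢v var i ∶ lookup Γ i
    ⊢unit : Γ ⊢v unit ∶ 𝟙
    ⊢pair : ∀ {v w a b} → Γ ⊢v v ∶ a → Γ ⊢v w ∶ b → Γ ⊢v pair v w ∶ (a ⊗ b)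
    ⊢lam  : ∀ {e a b} → (a ∷ᵥ Γ) ⊢ e ∶ b → Γ ⊢v lam e ∶ (a ⇒ b)
    ⊢inj  : ∀ {i v τ τs σ} → Nth (τ ∷ τs) i σ → Γ ⊢v v ∶ (σ [ μ τ τs ]T) →
            Γ ⊢v inj i v ∶ μ τ τs
    ⊢tlam : ∀ {e τ} → wkCtx Γ ⊢ e ∶ τ → Γ ⊢v tlam e ∶ ∀' τ

  data _⊢_∶_ {d m : ℕ} (Γ : Ctx d m) : Tm d m → Ty d → Set where
    ⊢val   : ∀ {v τ} → Γ ⊢v v ∶ τ → Γ ⊢ val v ∶ τ
    ⊢?     : Γ ⊢ ?? ∶ nat
    ⊢projL : ∀ {v a b} → Γ ⊢v v ∶ (a ⊗ b) → Γ ⊢ projL v ∶ a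
    ⊢projR : ∀ {v a b} → Γ ⊢v v ∶ (a ⊗ b) → Γ ⊢ projR v ∶ b
    ⊢app   : ∀ {v e a b} → Γ ⊢v v ∶ (a ⇒ b) → Γ ⊢ e ∶ a → Γ ⊢ app v e ∶ b
    ⊢case  : ∀ {v τ τs bs σ} → Γ ⊢v v ∶ μ τ τs →
             ⊢Branches Γ (μ τ τs) (τ ∷ τs) bs σ → Γ ⊢ case v bs ∶ σ
    ⊢tapp  : ∀ {v τ} → Γ ⊢v v ∶ ∀' τ → (σ : Ty d) → Γ ⊢ tapp v σ ∶ (τ [ σ ]T)

  data ⊢Branches {d m : ℕ} (Γ : Ctx d m) (ρ : Ty d) :
         List (Ty (suc d)) → List (Tm d (suc m)) → Ty d → Set where
    []  : ∀ {σ} → ⊢Branches Γ ρ [] [] σ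
    _∷_ : ∀ {τ τs e bs σ} → ((τ [ ρ ]T) ∷ᵥ Γ) ⊢ e ∶ σ →
          ⊢Branches Γ ρ τs bs σ → ⊢Branches Γ ρ (τ ∷ τs) (e ∷ bs) σ

TRel : Set₁
TRel = (d m : ℕ) → Ctx d m → Tm d m → Tm d m → Ty d → Set

TypeIndexed : TRel → Set
TypeIndexed R = ∀ {d m Γ e e' τ} → R d m Γ e e' τ → (Γ ⊢ e ∶ τ) × (Γ ⊢ e' ∶ τ)

data RelBranches (R : TRel) {d m : ℕ} (Γ : Ctx d m) (ρ : Ty d) :
       List (Ty (suc d)) → List (Tm d (suc m)) → List (Tm d (suc m)) → Ty d → Set where
  []  : ∀ {σ} → RelBranches R Γ ρ [] [] [] σ
  _∷_ : ∀ {τ τs e e' bs bs' σ} → R d (suc m) ((τ [ ρ ]T) ∷ᵥ Γ) e e' σ →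
        RelBranches R Γ ρ τs bs bs' σ → RelBranches R Γ ρ (τ ∷ τs) (e ∷ bs) (e' ∷ bs') σ

record Compatible (R : TRel) : Set where
  field
    c-var   : ∀ {d m} {Γ : Ctx d m} (i : Fin m) →
              R d m Γ (val (var i)) (val (var i)) (lookup Γ i)
    c-unit  : ∀ {d m} {Γ : Ctx d m} → R d m Γ (val unit) (val unit) 𝟙
    c-?     : ∀ {d m} {Γ : Ctx d m} → R d m Γ ?? ?? nat
    c-pair  : ∀ {d m} {Γ : Ctx d m} {v v' w w' a b} →
              R d m Γ (val v) (val v') a → R d m Γ (val w) (val w') b →
              R d m Γ (val (pair v w)) (val (pair v' w')) (a ⊗ b)
    c-lam   : ∀ {d m} {Γ : Ctx d m} {e e' a b} →
              R d (suc m) (a ∷ᵥ Γ) e e' b →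
              R d m Γ (val (lam e)) (val (lam e')) (a ⇒ b)
    c-inj   : ∀ {d m} {Γ : Ctx d m} {i v v' τ τs σ} → Nth (τ ∷ τs) i σ →
              R d m Γ (val v) (val v') (σ [ μ τ τs ]T) →
              R d m Γ (val (inj i v)) (val (inj i v')) (μ τ τs)
    c-tlam  : ∀ {d m} {Γ : Ctx d m} {e e' τ} →
              R (suc d) m (wkCtx Γ) e e' τ →
              R d m Γ (val (tlam e)) (val (tlam e')) (∀' τ)
    c-projL : ∀ {d m} {Γ : Ctx d m} {v v' a b} →
              R d m Γ (val v) (val v') (a ⊗ b) → R d m Γ (projL v) (projL v') a
    c-projR : ∀ {d m} {Γ : Ctx d m} {v v' a b} →
              R d m Γ (val v) (val v') (a ⊗ b) → R d m Γ (projR v) (projR v') b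
    c-app   : ∀ {d m} {Γ : Ctx d m} {v v' e e' a b} →
              R d m Γ (val v) (val v') (a ⇒ b) → R d m Γ e e' a →
              R d m Γ (app v e) (app v' e') b
    c-case  : ∀ {d m} {Γ : Ctx d m} {v v' τ τs bs bs' σ} →
              R d m Γ (val v) (val v') (μ τ τs) →
              RelBranches R Γ (μ τ τs) (τ ∷ τs) bs bs' σ →
              R d m Γ (case v bs) (case v' bs') σ
    c-tapp  : ∀ {d m} {Γ : Ctx d m} {v v' τ} →
              R d m Γ (val v) (val v') (∀' τ) → (σ : Ty d) →
              R d m Γ (tapp v σ) (tapp v' σ) (τ [ σ ]T)

Reflexive : TRel → Set
Reflexive R = ∀ {d m} {Γ : Ctx d m} {e τ} → Γ ⊢ e ∶ τ → R d m Γ e e τ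

Transitive : TRel → Set
Transitive R = ∀ {d m} {Γ : Ctx d m} {e₁ e₂ e₃ τ} →
               R d m Γ e₁ e₂ τ → R d m Γ e₂ e₃ τ → R d m Γ e₁ e₃ τ

record Precongruence (R : TRel) : Set where
  field
    typed      : TypeIndexed R
    reflexive  : Reflexive R
    transitive : Transitive R
    compatible : Compatible R

MayAdequate : TRel → Set
MayAdequate R = ∀ {e e' τ} → R 0 0 []ᵥ e e' τ → e ↓ → e' ↓

MustAdequate : TRel → Set
MustAdequate R = ∀ {e e' τ} → R 0 0 []ᵥ e e' τ → e ⇓ → e' ⇓

-- the largest may-/must-adequate precongruence: union of all of them
_⊢_≲may_∶_ : ∀ {d m} → Ctx d m → Tm d m → Tm d m → Ty d → Set₁
_⊢_≲may_∶_ {d} {m} Γ e e' τ =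
  Σ TRel λ R → Precongruence R × MayAdequate R × R d m Γ e e' τ

_⊢_≲must_∶_ : ∀ {d m} → Ctx d m → Tm d m → Tm d m → Ty d → Set₁
_⊢_≲must_∶_ {d} {m} Γ e e' τ =
  Σ TRel λ R → Precongruence R × MustAdequate R × R d m Γ e e' τ

_⊢_≅ctx_∶_ : ∀ {d m} → Ctx d m → Tm d m → Tm d m → Ty d → Set₁
Γ ⊢ e ≅ctx e' ∶ τ =
  (Γ ⊢ e ≲may e' ∶ τ) × (Γ ⊢ e' ≲may e ∶ τ) ×
  (Γ ⊢ e ≲must e' ∶ τ) × (Γ ⊢ e' ≲must e ∶ τ)

-- fix = Λα.Λβ.λf. δ_f (in δ_f)
-- δ_f = λy. case y of (in y' ⇒ f (λx. let r = y' y in r x)),  let r = e in e' = (λr.e') e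
δ-fix : Val 2 1
δ-fix =
  lam (case (var zero)
        (app (var (suc (suc zero)))                                   -- f
             (val (lam (app (lam (app (var zero) (val (var (suc zero)))))  -- λr. r x
                            (app (var (suc zero)) (val (var (suc (suc zero)))))))) -- y' y
         ∷ []))

fixV : Val 0 0
fixV = tlam (val (tlam (val (lam (app δ-fix (val (inj zero δ-fix)))))))

τ₀ : Ty 0
τ₀ = μ nat (((` zero) ⇒ (` zero)) ∷ [])

-- f = λh.λx. case x of (in₁ y ⇒ in₁ y | in₂ g ⇒ in₂ (λy. h (g (h y))))
fV : ∀ {m} → Val 0 m
fV = lam (val (lam (case (var zero)
       ( val (inj zero (var zero))
       ∷ val (inj (suc zero) (lam
           (app (var (suc (suc (suc zero))))
                (app (var (suc zero))
                     (app (var (suc (suc (suc zero)))) (val (var zero)))))))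
       ∷ []))))

-- fix[τ][τ] f = let x = fix[τ] in let y = x[τ] in y f
fixττf : Tm 0 0
fixττf = app (lam (app (lam (app (var zero) (val fV)))
                       (tapp (var zero) τ₀)))
             (tapp fixV τ₀)

idTm : Tm 0 0
idTm = val (lam (val (var zero)))

module Submission where

-- Idea.  fix[τ][τ] f reduces deterministically to the value F = f H, where
-- H = λx. let r = D (in D) in r x is the recursive call packaged by fix
-- (D = δ_f), and every call H a reduces deterministically to F a.  So F, H
-- and the wrapped functions λy. H (g (H y)) that F produces all behave as
-- the identity.  We capture this by a relation Sim e e' ("e behaves like
-- e'") that is closed under all term constructors and relates F to id, each
-- reduct of fix[τ][τ] f to id, H e to e', and so on.  A weight on Sim-proofs
-- measures how many administrative steps the left side still owes.  The
-- central lemma (progress) says: for closed, well-typed e with Sim e e',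
-- either e is a value, or e takes a deterministic administrative step that
-- lowers the weight, or e and e' step in lockstep.  Hence Sim preserves and
-- reflects may- and must-termination.  Typed chains of Sim-steps (resp. of
-- converse Sim-steps) form a precongruence, because Sim is compatible and
-- closed under substitution; with adequacy this gives the four inequalities.

open import Defs
open import Data.Vec using (lookup) renaming ([] to []ᵥ; _∷_ to _∷ᵥ_; map to mapᵥ)
open import Data.Vec.Properties using (lookup-map; map-∘; map-cong)
open import Data.Nat using (ℕ; zero; suc; _+_; _<_; z≤n; s≤s)
open import Data.Nat.Properties using (≤-refl; +-monoʳ-<; +-monoˡ-<)
open import Data.Nat.Induction using (<-wellFounded)
open import Induction.WellFounded using (Acc; acc)
open import Data.Fin using (Fin; zero; suc)
open import Data.List using (List; []; _∷_)
open import Data.Bool using (Bool; true; false)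
open import Data.Product using (Σ; _×_; _,_; proj₁; proj₂)
open import Data.Sum using (_⊎_; inj₁; inj₂)
open import Data.Empty using (⊥; ⊥-elim)
open import Relation.Binary.PropositionalEquality
open import Relation.Binary.Construct.Closure.ReflexiveTransitive using (Star; ε; _◅_; _◅◅_; gmap)
open import Function using (_∘_)

extR-cong : ∀ {n k} {ρ ρ' : Fin n → Fin k} → (∀ i → ρ i ≡ ρ' i) → ∀ i → extR ρ i ≡ extR ρ' i
extR-cong h zero = refl
extR-cong h (suc i) = cong suc (h i)

extS-cong : ∀ {n k} {ρ ρ' : Fin n → Ty k} → (∀ i → ρ i ≡ ρ' i) → ∀ i → extS ρ i ≡ extS ρ' i
extS-cong h zero = refl
extS-cong h (suc i) = cong (renT suc) (h i)

extR-∘ : ∀ {n k l} (ρ : Fin k → Fin l) (ξ : Fin n → Fin k) → ∀ i → extR ρ (extR ξ i) ≡ extR (ρ ∘ ξ) i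
extR-∘ ρ ξ zero = refl
extR-∘ ρ ξ (suc i) = refl

extS-extR : ∀ {n k l} (σ : Fin k → Ty l) (ξ : Fin n → Fin k) → ∀ i → extS σ (extR ξ i) ≡ extS (σ ∘ ξ) i
extS-extR σ ξ zero = refl
extS-extR σ ξ (suc i) = refl

extS-var : ∀ {n} → ∀ i → extS {n} `_ i ≡ ` i
extS-var zero = refl
extS-var (suc i) = refl

extR-var : ∀ {n k} (ρ : Fin n → Fin k) → ∀ i → ` (extR ρ i) ≡ extS (`_ ∘ ρ) i
extR-var ρ zero = refl
extR-var ρ (suc i) = refl

mutual
  renT-cong : ∀ {n k} {ρ ρ' : Fin n → Fin k} → (∀ i → ρ i ≡ ρ' i) → ∀ τ → renT ρ τ ≡ renT ρ' τ
  renT-cong h (` i) = cong `_ (h i)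
  renT-cong h 𝟙 = refl
  renT-cong h (a ⊗ b) = cong₂ _⊗_ (renT-cong h a) (renT-cong h b)
  renT-cong h (a ⇒ b) = cong₂ _⇒_ (renT-cong h a) (renT-cong h b)
  renT-cong h (μ a as) = cong₂ μ (renT-cong (extR-cong h) a) (renTs-cong (extR-cong h) as)
  renT-cong h (∀' a) = cong ∀' (renT-cong (extR-cong h) a)

  renTs-cong : ∀ {n k} {ρ ρ' : Fin n → Fin k} → (∀ i → ρ i ≡ ρ' i) → ∀ τs → renTs ρ τs ≡ renTs ρ' τs
  renTs-cong h [] = refl
  renTs-cong h (a ∷ as) = cong₂ _∷_ (renT-cong h a) (renTs-cong h as)

mutual
  subT-cong : ∀ {n k} {ρ ρ' : Fin n → Ty k} → (∀ i → ρ i ≡ ρ' i) → ∀ τ → subT ρ τ ≡ subT ρ' τ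
  subT-cong h (` i) = h i
  subT-cong h 𝟙 = refl
  subT-cong h (a ⊗ b) = cong₂ _⊗_ (subT-cong h a) (subT-cong h b)
  subT-cong h (a ⇒ b) = cong₂ _⇒_ (subT-cong h a) (subT-cong h b)
  subT-cong h (μ a as) = cong₂ μ (subT-cong (extS-cong h) a) (subTs-cong (extS-cong h) as)
  subT-cong h (∀' a) = cong ∀' (subT-cong (extS-cong h) a)

  subTs-cong : ∀ {n k} {ρ ρ' : Fin n → Ty k} → (∀ i → ρ i ≡ ρ' i) → ∀ τs → subTs ρ τs ≡ subTs ρ' τs
  subTs-cong h [] = refl
  subTs-cong h (a ∷ as) = cong₂ _∷_ (subT-cong h a) (subTs-cong h as)

mutual
  renT-renT : ∀ {n k l} (ρ : Fin k → Fin l) (ξ : Fin n → Fin k) τ → renT ρ (renT ξ τ) ≡ renT (ρ ∘ ξ) τ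
  renT-renT ρ ξ (` i) = refl
  renT-renT ρ ξ 𝟙 = refl
  renT-renT ρ ξ (a ⊗ b) = cong₂ _⊗_ (renT-renT ρ ξ a) (renT-renT ρ ξ b)
  renT-renT ρ ξ (a ⇒ b) = cong₂ _⇒_ (renT-renT ρ ξ a) (renT-renT ρ ξ b)
  renT-renT ρ ξ (μ a as) = cong₂ μ (trans (renT-renT (extR ρ) (extR ξ) a) (renT-cong (extR-∘ ρ ξ) a))
                                    (trans (renTs-renTs (extR ρ) (extR ξ) as) (renTs-cong (extR-∘ ρ ξ) as))
  renT-renT ρ ξ (∀' a) = cong ∀' (trans (renT-renT (extR ρ) (extR ξ) a) (renT-cong (extR-∘ ρ ξ) a))

  renTs-renTs : ∀ {n k l} (ρ : Fin k → Fin l) (ξ : Fin n → Fin k) τs → renTs ρ (renTs ξ τs) ≡ renTs (ρ ∘ ξ) τs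
  renTs-renTs ρ ξ [] = refl
  renTs-renTs ρ ξ (a ∷ as) = cong₂ _∷_ (renT-renT ρ ξ a) (renTs-renTs ρ ξ as)

mutual
  subT-renT : ∀ {n k l} (σ : Fin k → Ty l) (ξ : Fin n → Fin k) τ → subT σ (renT ξ τ) ≡ subT (σ ∘ ξ) τ
  subT-renT σ ξ (` i) = refl
  subT-renT σ ξ 𝟙 = refl
  subT-renT σ ξ (a ⊗ b) = cong₂ _⊗_ (subT-renT σ ξ a) (subT-renT σ ξ b)
  subT-renT σ ξ (a ⇒ b) = cong₂ _⇒_ (subT-renT σ ξ a) (subT-renT σ ξ b)
  subT-renT σ ξ (μ a as) = cong₂ μ (trans (subT-renT (extS σ) (extR ξ) a) (subT-cong (extS-extR σ ξ) a))
                                    (trans (subTs-renTs (extS σ) (extR ξ) as) (subTs-cong (extS-extR σ ξ) as))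
  subT-renT σ ξ (∀' a) = cong ∀' (trans (subT-renT (extS σ) (extR ξ) a) (subT-cong (extS-extR σ ξ) a))

  subTs-renTs : ∀ {n k l} (σ : Fin k → Ty l) (ξ : Fin n → Fin k) τs → subTs σ (renTs ξ τs) ≡ subTs (σ ∘ ξ) τs
  subTs-renTs σ ξ [] = refl
  subTs-renTs σ ξ (a ∷ as) = cong₂ _∷_ (subT-renT σ ξ a) (subTs-renTs σ ξ as)

extS-renT : ∀ {n k l} (ρ : Fin k → Fin l) (σ : Fin n → Ty k) → ∀ i → renT (extR ρ) (extS σ i) ≡ extS (renT ρ ∘ σ) i
extS-renT ρ σ zero = refl
extS-renT ρ σ (suc i) = trans (renT-renT (extR ρ) suc (σ i)) (sym (renT-renT suc ρ (σ i)))

mutual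
  renT-subT : ∀ {n k l} (ρ : Fin k → Fin l) (σ : Fin n → Ty k) τ → renT ρ (subT σ τ) ≡ subT (renT ρ ∘ σ) τ
  renT-subT ρ σ (` i) = refl
  renT-subT ρ σ 𝟙 = refl
  renT-subT ρ σ (a ⊗ b) = cong₂ _⊗_ (renT-subT ρ σ a) (renT-subT ρ σ b)
  renT-subT ρ σ (a ⇒ b) = cong₂ _⇒_ (renT-subT ρ σ a) (renT-subT ρ σ b)
  renT-subT ρ σ (μ a as) = cong₂ μ (trans (renT-subT (extR ρ) (extS σ) a) (subT-cong (extS-renT ρ σ) a))
                                    (trans (renTs-subTs (extR ρ) (extS σ) as) (subTs-cong (extS-renT ρ σ) as))
  renT-subT ρ σ (∀' a) = cong ∀' (trans (renT-subT (extR ρ) (extS σ) a) (subT-cong (extS-renT ρ σ) a))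

  renTs-subTs : ∀ {n k l} (ρ : Fin k → Fin l) (σ : Fin n → Ty k) τs → renTs ρ (subTs σ τs) ≡ subTs (renT ρ ∘ σ) τs
  renTs-subTs ρ σ [] = refl
  renTs-subTs ρ σ (a ∷ as) = cong₂ _∷_ (renT-subT ρ σ a) (renTs-subTs ρ σ as)

extS-subT : ∀ {n k l} (ρ : Fin k → Ty l) (σ : Fin n → Ty k) → ∀ i → subT (extS ρ) (extS σ i) ≡ extS (subT ρ ∘ σ) i
extS-subT ρ σ zero = refl
extS-subT ρ σ (suc i) = trans (subT-renT (extS ρ) suc (σ i)) (sym (renT-subT suc ρ (σ i)))

mutual
  subT-subT : ∀ {n k l} (ρ : Fin k → Ty l) (σ : Fin n → Ty k) τ → subT ρ (subT σ τ) ≡ subT (subT ρ ∘ σ) τ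
  subT-subT ρ σ (` i) = refl
  subT-subT ρ σ 𝟙 = refl
  subT-subT ρ σ (a ⊗ b) = cong₂ _⊗_ (subT-subT ρ σ a) (subT-subT ρ σ b)
  subT-subT ρ σ (a ⇒ b) = cong₂ _⇒_ (subT-subT ρ σ a) (subT-subT ρ σ b)
  subT-subT ρ σ (μ a as) = cong₂ μ (trans (subT-subT (extS ρ) (extS σ) a) (subT-cong (extS-subT ρ σ) a))
                                    (trans (subTs-subTs (extS ρ) (extS σ) as) (subTs-cong (extS-subT ρ σ) as))
  subT-subT ρ σ (∀' a) = cong ∀' (trans (subT-subT (extS ρ) (extS σ) a) (subT-cong (extS-subT ρ σ) a))

  subTs-subTs : ∀ {n k l} (ρ : Fin k → Ty l) (σ : Fin n → Ty k) τs → subTs ρ (subTs σ τs) ≡ subTs (subT ρ ∘ σ) τs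
  subTs-subTs ρ σ [] = refl
  subTs-subTs ρ σ (a ∷ as) = cong₂ _∷_ (subT-subT ρ σ a) (subTs-subTs ρ σ as)

mutual
  subT-id : ∀ {n} (τ : Ty n) → subT `_ τ ≡ τ
  subT-id (` i) = refl
  subT-id 𝟙 = refl
  subT-id (a ⊗ b) = cong₂ _⊗_ (subT-id a) (subT-id b)
  subT-id (a ⇒ b) = cong₂ _⇒_ (subT-id a) (subT-id b)
  subT-id (μ a as) = cong₂ μ (trans (subT-cong (extS-var) a) (subT-id a)) (trans (subTs-cong (extS-var) as) (subTs-id as))
  subT-id (∀' a) = cong ∀' (trans (subT-cong (extS-var) a) (subT-id a))

  subTs-id : ∀ {n} (τs : List (Ty n)) → subTs `_ τs ≡ τs
  subTs-id [] = refl
  subTs-id (a ∷ as) = cong₂ _∷_ (subT-id a) (subTs-id as)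

mutual
  renT=subT : ∀ {n k} (ρ : Fin n → Fin k) τ → renT ρ τ ≡ subT (`_ ∘ ρ) τ
  renT=subT ρ (` i) = refl
  renT=subT ρ 𝟙 = refl
  renT=subT ρ (a ⊗ b) = cong₂ _⊗_ (renT=subT ρ a) (renT=subT ρ b)
  renT=subT ρ (a ⇒ b) = cong₂ _⇒_ (renT=subT ρ a) (renT=subT ρ b)
  renT=subT ρ (μ a as) = cong₂ μ (trans (renT=subT (extR ρ) a) (subT-cong (extR-var ρ) a)) (trans (renTs=subTs (extR ρ) as) (subTs-cong (extR-var ρ) as))
  renT=subT ρ (∀' a) = cong ∀' (trans (renT=subT (extR ρ) a) (subT-cong (extR-var ρ) a))

  renTs=subTs : ∀ {n k} (ρ : Fin n → Fin k) τs → renTs ρ τs ≡ subTs (`_ ∘ ρ) τs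
  renTs=subTs ρ [] = refl
  renTs=subTs ρ (a ∷ as) = cong₂ _∷_ (renT=subT ρ a) (renTs=subTs ρ as)

s1T : ∀ {d} → Ty d → Fin (suc d) → Ty d
s1T σ zero = σ
s1T σ (suc i) = ` i

[]T≡subT : ∀ {d} (τ : Ty (suc d)) (σ : Ty d) → τ [ σ ]T ≡ subT (s1T σ) τ
[]T≡subT τ σ = subT-cong (λ { zero → refl ; (suc i) → refl }) τ

sub-s1T : ∀ {n k} (ρ : Fin n → Ty k) (σ : Ty n) → ∀ i → subT ρ (s1T σ i) ≡ subT (s1T (subT ρ σ)) (extS ρ i)
sub-s1T ρ σ zero = refl
sub-s1T ρ σ (suc i) = sym (trans (subT-renT _ suc (ρ i)) (subT-id (ρ i)))

sub-single : ∀ {n k} (ρ : Fin n → Ty k) (τ : Ty (suc n)) σ → subT ρ (τ [ σ ]T) ≡ (subT (extS ρ) τ) [ subT ρ σ ]T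
sub-single ρ τ σ = begin
  subT ρ (τ [ σ ]T)                          ≡⟨ cong (subT ρ) ([]T≡subT τ σ) ⟩
  subT ρ (subT (s1T σ) τ)                    ≡⟨ subT-subT ρ (s1T σ) τ ⟩
  subT (subT ρ ∘ s1T σ) τ                    ≡⟨ subT-cong (sub-s1T ρ σ) τ ⟩
  subT (subT (s1T (subT ρ σ)) ∘ extS ρ) τ    ≡⟨ sym (subT-subT _ (extS ρ) τ) ⟩
  subT (s1T (subT ρ σ)) (subT (extS ρ) τ)    ≡⟨ sym ([]T≡subT (subT (extS ρ) τ) (subT ρ σ)) ⟩
  (subT (extS ρ) τ) [ subT ρ σ ]T            ∎
  where open ≡-Reasoning

wk-sub : ∀ {n k} (ρ : Fin n → Ty k) τ → subT (extS ρ) (renT suc τ) ≡ renT suc (subT ρ τ)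
wk-sub ρ τ = trans (subT-renT (extS ρ) suc τ) (sym (renT-subT suc ρ τ))

extsV-extR : ∀ {d m k l} (σ : Fin k → Val d l) (ξ : Fin m → Fin k) → ∀ i → extsV σ (extR ξ i) ≡ extsV (σ ∘ ξ) i
extsV-extR σ ξ zero = refl
extsV-extR σ ξ (suc i) = refl

mutual
  renV-cong : ∀ {d m k} {ρ ρ' : Fin m → Fin k} → (∀ i → ρ i ≡ ρ' i) → (v : Val d m) → renV ρ v ≡ renV ρ' v
  renV-cong h (var i) = cong var (h i)
  renV-cong h unit = refl
  renV-cong h (pair v w) = cong₂ pair (renV-cong h v) (renV-cong h w)
  renV-cong h (lam e) = cong lam (renTm-cong (extR-cong h) e)
  renV-cong h (inj i v) = cong (inj i) (renV-cong h v)
  renV-cong h (tlam e) = cong tlam (renTm-cong h e)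

  renTm-cong : ∀ {d m k} {ρ ρ' : Fin m → Fin k} → (∀ i → ρ i ≡ ρ' i) → (e : Tm d m) → renTm ρ e ≡ renTm ρ' e
  renTm-cong h (val v) = cong val (renV-cong h v)
  renTm-cong h ?? = refl
  renTm-cong h (projL v) = cong projL (renV-cong h v)
  renTm-cong h (projR v) = cong projR (renV-cong h v)
  renTm-cong h (app v e) = cong₂ app (renV-cong h v) (renTm-cong h e)
  renTm-cong h (case v bs) = cong₂ case (renV-cong h v) (renBs-cong (extR-cong h) bs)
  renTm-cong h (tapp v τ) = cong (λ x → tapp x τ) (renV-cong h v)

  renBs-cong : ∀ {d m k} {ρ ρ' : Fin m → Fin k} → (∀ i → ρ i ≡ ρ' i) → (bs : List (Tm d m)) → renBs ρ bs ≡ renBs ρ' bs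
  renBs-cong h [] = refl
  renBs-cong h (e ∷ bs) = cong₂ _∷_ (renTm-cong h e) (renBs-cong h bs)

extsV-cong : ∀ {d m k} {σ σ' : Fin m → Val d k} → (∀ i → σ i ≡ σ' i) → ∀ i → extsV σ i ≡ extsV σ' i
extsV-cong h zero = refl
extsV-cong h (suc i) = cong (renV suc) (h i)

mutual
  subV-cong : ∀ {d m k} {σ σ' : Fin m → Val d k} → (∀ i → σ i ≡ σ' i) → (v : Val d m) → subV σ v ≡ subV σ' v
  subV-cong h (var i) = h i
  subV-cong h unit = refl
  subV-cong h (pair v w) = cong₂ pair (subV-cong h v) (subV-cong h w)
  subV-cong h (lam e) = cong lam (subTm-cong (extsV-cong h) e)
  subV-cong h (inj i v) = cong (inj i) (subV-cong h v)
  subV-cong h (tlam e) = cong tlam (subTm-cong (λ i → cong (tyRenV suc) (h i)) e)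

  subTm-cong : ∀ {d m k} {σ σ' : Fin m → Val d k} → (∀ i → σ i ≡ σ' i) → (e : Tm d m) → subTm σ e ≡ subTm σ' e
  subTm-cong h (val v) = cong val (subV-cong h v)
  subTm-cong h ?? = refl
  subTm-cong h (projL v) = cong projL (subV-cong h v)
  subTm-cong h (projR v) = cong projR (subV-cong h v)
  subTm-cong h (app v e) = cong₂ app (subV-cong h v) (subTm-cong h e)
  subTm-cong h (case v bs) = cong₂ case (subV-cong h v) (subBs-cong (extsV-cong h) bs)
  subTm-cong h (tapp v τ) = cong (λ x → tapp x τ) (subV-cong h v)

  subBs-cong : ∀ {d m k} {σ σ' : Fin m → Val d k} → (∀ i → σ i ≡ σ' i) → (bs : List (Tm d m)) → subBs σ bs ≡ subBs σ' bs
  subBs-cong h [] = refl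
  subBs-cong h (e ∷ bs) = cong₂ _∷_ (subTm-cong h e) (subBs-cong h bs)

mutual
  tsubV-cong : ∀ {d d' m} {ρ ρ' : Fin d → Ty d'} → (∀ i → ρ i ≡ ρ' i) → (v : Val d m) → tsubV ρ v ≡ tsubV ρ' v
  tsubV-cong h (var i) = refl
  tsubV-cong h unit = refl
  tsubV-cong h (pair v w) = cong₂ pair (tsubV-cong h v) (tsubV-cong h w)
  tsubV-cong h (lam e) = cong lam (tsubTm-cong h e)
  tsubV-cong h (inj i v) = cong (inj i) (tsubV-cong h v)
  tsubV-cong h (tlam e) = cong tlam (tsubTm-cong (extS-cong h) e)

  tsubTm-cong : ∀ {d d' m} {ρ ρ' : Fin d → Ty d'} → (∀ i → ρ i ≡ ρ' i) → (e : Tm d m) → tsubTm ρ e ≡ tsubTm ρ' e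
  tsubTm-cong h (val v) = cong val (tsubV-cong h v)
  tsubTm-cong h ?? = refl
  tsubTm-cong h (projL v) = cong projL (tsubV-cong h v)
  tsubTm-cong h (projR v) = cong projR (tsubV-cong h v)
  tsubTm-cong h (app v e) = cong₂ app (tsubV-cong h v) (tsubTm-cong h e)
  tsubTm-cong h (case v bs) = cong₂ case (tsubV-cong h v) (tsubBs-cong h bs)
  tsubTm-cong h (tapp v τ) = cong₂ tapp (tsubV-cong h v) (subT-cong h τ)

  tsubBs-cong : ∀ {d d' m} {ρ ρ' : Fin d → Ty d'} → (∀ i → ρ i ≡ ρ' i) → (bs : List (Tm d m)) → tsubBs ρ bs ≡ tsubBs ρ' bs
  tsubBs-cong h [] = refl
  tsubBs-cong h (e ∷ bs) = cong₂ _∷_ (tsubTm-cong h e) (tsubBs-cong h bs)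

mutual
  renV-renV : ∀ {d m k l} (ρ : Fin k → Fin l) (ξ : Fin m → Fin k) (v : Val d m) → renV ρ (renV ξ v) ≡ renV (ρ ∘ ξ) v
  renV-renV ρ ξ (var i) = refl
  renV-renV ρ ξ unit = refl
  renV-renV ρ ξ (pair v w) = cong₂ pair (renV-renV ρ ξ v) (renV-renV ρ ξ w)
  renV-renV ρ ξ (lam e) = cong lam (trans (renTm-renTm (extR ρ) (extR ξ) e) (renTm-cong (extR-∘ ρ ξ) e))
  renV-renV ρ ξ (inj i v) = cong (inj i) (renV-renV ρ ξ v)
  renV-renV ρ ξ (tlam e) = cong tlam (renTm-renTm ρ ξ e)

  renTm-renTm : ∀ {d m k l} (ρ : Fin k → Fin l) (ξ : Fin m → Fin k) (e : Tm d m) → renTm ρ (renTm ξ e) ≡ renTm (ρ ∘ ξ) e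
  renTm-renTm ρ ξ (val v) = cong val (renV-renV ρ ξ v)
  renTm-renTm ρ ξ ?? = refl
  renTm-renTm ρ ξ (projL v) = cong projL (renV-renV ρ ξ v)
  renTm-renTm ρ ξ (projR v) = cong projR (renV-renV ρ ξ v)
  renTm-renTm ρ ξ (app v e) = cong₂ app (renV-renV ρ ξ v) (renTm-renTm ρ ξ e)
  renTm-renTm ρ ξ (case v bs) = cong₂ case (renV-renV ρ ξ v) (trans (renBs-renBs (extR ρ) (extR ξ) bs) (renBs-cong (extR-∘ ρ ξ) bs))
  renTm-renTm ρ ξ (tapp v τ) = cong (λ x → tapp x τ) (renV-renV ρ ξ v)

  renBs-renBs : ∀ {d m k l} (ρ : Fin k → Fin l) (ξ : Fin m → Fin k) (bs : List (Tm d m)) → renBs ρ (renBs ξ bs) ≡ renBs (ρ ∘ ξ) bs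
  renBs-renBs ρ ξ [] = refl
  renBs-renBs ρ ξ (e ∷ bs) = cong₂ _∷_ (renTm-renTm ρ ξ e) (renBs-renBs ρ ξ bs)

mutual
  renV-tyRenV : ∀ {d d' m k} (ρ : Fin m → Fin k) (ξ : Fin d → Fin d') (v : Val d m) → renV ρ (tyRenV ξ v) ≡ tyRenV ξ (renV ρ v)
  renV-tyRenV ρ ξ (var i) = refl
  renV-tyRenV ρ ξ unit = refl
  renV-tyRenV ρ ξ (pair v w) = cong₂ pair (renV-tyRenV ρ ξ v) (renV-tyRenV ρ ξ w)
  renV-tyRenV ρ ξ (lam e) = cong lam (renTm-tyRenTm (extR ρ) ξ e)
  renV-tyRenV ρ ξ (inj i v) = cong (inj i) (renV-tyRenV ρ ξ v)
  renV-tyRenV ρ ξ (tlam e) = cong tlam (renTm-tyRenTm ρ (extR ξ) e)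

  renTm-tyRenTm : ∀ {d d' m k} (ρ : Fin m → Fin k) (ξ : Fin d → Fin d') (e : Tm d m) → renTm ρ (tyRenTm ξ e) ≡ tyRenTm ξ (renTm ρ e)
  renTm-tyRenTm ρ ξ (val v) = cong val (renV-tyRenV ρ ξ v)
  renTm-tyRenTm ρ ξ ?? = refl
  renTm-tyRenTm ρ ξ (projL v) = cong projL (renV-tyRenV ρ ξ v)
  renTm-tyRenTm ρ ξ (projR v) = cong projR (renV-tyRenV ρ ξ v)
  renTm-tyRenTm ρ ξ (app v e) = cong₂ app (renV-tyRenV ρ ξ v) (renTm-tyRenTm ρ ξ e)
  renTm-tyRenTm ρ ξ (case v bs) = cong₂ case (renV-tyRenV ρ ξ v) (renBs-tyRenBs (extR ρ) ξ bs)
  renTm-tyRenTm ρ ξ (tapp v τ) = cong (λ x → tapp x (renT ξ τ)) (renV-tyRenV ρ ξ v)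

  renBs-tyRenBs : ∀ {d d' m k} (ρ : Fin m → Fin k) (ξ : Fin d → Fin d') (bs : List (Tm d m)) → renBs ρ (tyRenBs ξ bs) ≡ tyRenBs ξ (renBs ρ bs)
  renBs-tyRenBs ρ ξ [] = refl
  renBs-tyRenBs ρ ξ (e ∷ bs) = cong₂ _∷_ (renTm-tyRenTm ρ ξ e) (renBs-tyRenBs ρ ξ bs)
extsV-ren : ∀ {d m k l} (ρ : Fin k → Fin l) (σ : Fin m → Val d k) → ∀ i → renV (extR ρ) (extsV σ i) ≡ extsV (renV ρ ∘ σ) i
extsV-ren ρ σ zero = refl
extsV-ren ρ σ (suc i) = trans (renV-renV (extR ρ) suc (σ i)) (sym (renV-renV suc ρ (σ i)))

mutual
  renV-subV : ∀ {d m k l} (ρ : Fin k → Fin l) (σ : Fin m → Val d k) (v : Val d m) → renV ρ (subV σ v) ≡ subV (renV ρ ∘ σ) v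
  renV-subV ρ σ (var i) = refl
  renV-subV ρ σ unit = refl
  renV-subV ρ σ (pair v w) = cong₂ pair (renV-subV ρ σ v) (renV-subV ρ σ w)
  renV-subV ρ σ (lam e) = cong lam (trans (renTm-subTm (extR ρ) (extsV σ) e) (subTm-cong (extsV-ren ρ σ) e))
  renV-subV ρ σ (inj i v) = cong (inj i) (renV-subV ρ σ v)
  renV-subV ρ σ (tlam e) = cong tlam (trans (renTm-subTm ρ _ e) (subTm-cong (λ i → renV-tyRenV ρ suc (σ i)) e))

  renTm-subTm : ∀ {d m k l} (ρ : Fin k → Fin l) (σ : Fin m → Val d k) (e : Tm d m) → renTm ρ (subTm σ e) ≡ subTm (renV ρ ∘ σ) e
  renTm-subTm ρ σ (val v) = cong val (renV-subV ρ σ v)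
  renTm-subTm ρ σ ?? = refl
  renTm-subTm ρ σ (projL v) = cong projL (renV-subV ρ σ v)
  renTm-subTm ρ σ (projR v) = cong projR (renV-subV ρ σ v)
  renTm-subTm ρ σ (app v e) = cong₂ app (renV-subV ρ σ v) (renTm-subTm ρ σ e)
  renTm-subTm ρ σ (case v bs) = cong₂ case (renV-subV ρ σ v) (trans (renBs-subBs (extR ρ) (extsV σ) bs) (subBs-cong (extsV-ren ρ σ) bs))
  renTm-subTm ρ σ (tapp v τ) = cong (λ x → tapp x τ) (renV-subV ρ σ v)

  renBs-subBs : ∀ {d m k l} (ρ : Fin k → Fin l) (σ : Fin m → Val d k) (bs : List (Tm d m)) → renBs ρ (subBs σ bs) ≡ subBs (renV ρ ∘ σ) bs
  renBs-subBs ρ σ [] = refl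
  renBs-subBs ρ σ (e ∷ bs) = cong₂ _∷_ (renTm-subTm ρ σ e) (renBs-subBs ρ σ bs)

mutual
  subV-renV : ∀ {d m k l} (σ : Fin k → Val d l) (ξ : Fin m → Fin k) (v : Val d m) → subV σ (renV ξ v) ≡ subV (σ ∘ ξ) v
  subV-renV σ ξ (var i) = refl
  subV-renV σ ξ unit = refl
  subV-renV σ ξ (pair v w) = cong₂ pair (subV-renV σ ξ v) (subV-renV σ ξ w)
  subV-renV σ ξ (lam e) = cong lam (trans (subTm-renTm (extsV σ) (extR ξ) e) (subTm-cong (extsV-extR σ ξ) e))
  subV-renV σ ξ (inj i v) = cong (inj i) (subV-renV σ ξ v)
  subV-renV σ ξ (tlam e) = cong tlam (subTm-renTm _ ξ e)

  subTm-renTm : ∀ {d m k l} (σ : Fin k → Val d l) (ξ : Fin m → Fin k) (e : Tm d m) → subTm σ (renTm ξ e) ≡ subTm (σ ∘ ξ) e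
  subTm-renTm σ ξ (val v) = cong val (subV-renV σ ξ v)
  subTm-renTm σ ξ ?? = refl
  subTm-renTm σ ξ (projL v) = cong projL (subV-renV σ ξ v)
  subTm-renTm σ ξ (projR v) = cong projR (subV-renV σ ξ v)
  subTm-renTm σ ξ (app v e) = cong₂ app (subV-renV σ ξ v) (subTm-renTm σ ξ e)
  subTm-renTm σ ξ (case v bs) = cong₂ case (subV-renV σ ξ v) (trans (subBs-renBs (extsV σ) (extR ξ) bs) (subBs-cong (extsV-extR σ ξ) bs))
  subTm-renTm σ ξ (tapp v τ) = cong (λ x → tapp x τ) (subV-renV σ ξ v)

  subBs-renBs : ∀ {d m k l} (σ : Fin k → Val d l) (ξ : Fin m → Fin k) (bs : List (Tm d m)) → subBs σ (renBs ξ bs) ≡ subBs (σ ∘ ξ) bs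
  subBs-renBs σ ξ [] = refl
  subBs-renBs σ ξ (e ∷ bs) = cong₂ _∷_ (subTm-renTm σ ξ e) (subBs-renBs σ ξ bs)

extsV-var : ∀ {d m} → ∀ i → extsV {d} {m} var i ≡ var i
extsV-var zero = refl
extsV-var (suc i) = refl

mutual
  subV-id : ∀ {d m} (v : Val d m) → subV var v ≡ v
  subV-id (var i) = refl
  subV-id unit = refl
  subV-id (pair v w) = cong₂ pair (subV-id v) (subV-id w)
  subV-id (lam e) = cong lam (trans (subTm-cong extsV-var e) (subTm-id e))
  subV-id (inj i v) = cong (inj i) (subV-id v)
  subV-id (tlam e) = cong tlam (subTm-id e)

  subTm-id : ∀ {d m} (e : Tm d m) → subTm var e ≡ e
  subTm-id (val v) = cong val (subV-id v)
  subTm-id ?? = refl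
  subTm-id (projL v) = cong projL (subV-id v)
  subTm-id (projR v) = cong projR (subV-id v)
  subTm-id (app v e) = cong₂ app (subV-id v) (subTm-id e)
  subTm-id (case v bs) = cong₂ case (subV-id v) (trans (subBs-cong extsV-var bs) (subBs-id bs))
  subTm-id (tapp v τ) = cong (λ x → tapp x τ) (subV-id v)

  subBs-id : ∀ {d m} (bs : List (Tm d m)) → subBs var bs ≡ bs
  subBs-id [] = refl
  subBs-id (e ∷ bs) = cong₂ _∷_ (subTm-id e) (subBs-id bs)

mutual
  tyRenV=tsubV : ∀ {d d' m} (ξ : Fin d → Fin d') (v : Val d m) → tyRenV ξ v ≡ tsubV (`_ ∘ ξ) v
  tyRenV=tsubV ξ (var i) = refl
  tyRenV=tsubV ξ unit = refl
  tyRenV=tsubV ξ (pair v w) = cong₂ pair (tyRenV=tsubV ξ v) (tyRenV=tsubV ξ w)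
  tyRenV=tsubV ξ (lam e) = cong lam (tyRenTm=tsubTm ξ e)
  tyRenV=tsubV ξ (inj i v) = cong (inj i) (tyRenV=tsubV ξ v)
  tyRenV=tsubV ξ (tlam e) = cong tlam (trans (tyRenTm=tsubTm (extR ξ) e) (tsubTm-cong (extR-var ξ) e))

  tyRenTm=tsubTm : ∀ {d d' m} (ξ : Fin d → Fin d') (e : Tm d m) → tyRenTm ξ e ≡ tsubTm (`_ ∘ ξ) e
  tyRenTm=tsubTm ξ (val v) = cong val (tyRenV=tsubV ξ v)
  tyRenTm=tsubTm ξ ?? = refl
  tyRenTm=tsubTm ξ (projL v) = cong projL (tyRenV=tsubV ξ v)
  tyRenTm=tsubTm ξ (projR v) = cong projR (tyRenV=tsubV ξ v)
  tyRenTm=tsubTm ξ (app v e) = cong₂ app (tyRenV=tsubV ξ v) (tyRenTm=tsubTm ξ e)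
  tyRenTm=tsubTm ξ (case v bs) = cong₂ case (tyRenV=tsubV ξ v) (tyRenBs=tsubBs ξ bs)
  tyRenTm=tsubTm ξ (tapp v τ) = cong₂ tapp (tyRenV=tsubV ξ v) (renT=subT ξ τ)

  tyRenBs=tsubBs : ∀ {d d' m} (ξ : Fin d → Fin d') (bs : List (Tm d m)) → tyRenBs ξ bs ≡ tsubBs (`_ ∘ ξ) bs
  tyRenBs=tsubBs ξ [] = refl
  tyRenBs=tsubBs ξ (e ∷ bs) = cong₂ _∷_ (tyRenTm=tsubTm ξ e) (tyRenBs=tsubBs ξ bs)

mutual
  tsubV-tsubV : ∀ {d d' d'' m} (ρ : Fin d' → Ty d'') (ρ' : Fin d → Ty d') (v : Val d m) → tsubV ρ (tsubV ρ' v) ≡ tsubV (subT ρ ∘ ρ') v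
  tsubV-tsubV ρ ρ' (var i) = refl
  tsubV-tsubV ρ ρ' unit = refl
  tsubV-tsubV ρ ρ' (pair v w) = cong₂ pair (tsubV-tsubV ρ ρ' v) (tsubV-tsubV ρ ρ' w)
  tsubV-tsubV ρ ρ' (lam e) = cong lam (tsubTm-tsubTm ρ ρ' e)
  tsubV-tsubV ρ ρ' (inj i v) = cong (inj i) (tsubV-tsubV ρ ρ' v)
  tsubV-tsubV ρ ρ' (tlam e) = cong tlam (trans (tsubTm-tsubTm (extS ρ) (extS ρ') e) (tsubTm-cong (extS-subT ρ ρ') e))

  tsubTm-tsubTm : ∀ {d d' d'' m} (ρ : Fin d' → Ty d'') (ρ' : Fin d → Ty d') (e : Tm d m) → tsubTm ρ (tsubTm ρ' e) ≡ tsubTm (subT ρ ∘ ρ') e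
  tsubTm-tsubTm ρ ρ' (val v) = cong val (tsubV-tsubV ρ ρ' v)
  tsubTm-tsubTm ρ ρ' ?? = refl
  tsubTm-tsubTm ρ ρ' (projL v) = cong projL (tsubV-tsubV ρ ρ' v)
  tsubTm-tsubTm ρ ρ' (projR v) = cong projR (tsubV-tsubV ρ ρ' v)
  tsubTm-tsubTm ρ ρ' (app v e) = cong₂ app (tsubV-tsubV ρ ρ' v) (tsubTm-tsubTm ρ ρ' e)
  tsubTm-tsubTm ρ ρ' (case v bs) = cong₂ case (tsubV-tsubV ρ ρ' v) (tsubBs-tsubBs ρ ρ' bs)
  tsubTm-tsubTm ρ ρ' (tapp v τ) = cong₂ tapp (tsubV-tsubV ρ ρ' v) (subT-subT ρ ρ' τ)

  tsubBs-tsubBs : ∀ {d d' d'' m} (ρ : Fin d' → Ty d'') (ρ' : Fin d → Ty d') (bs : List (Tm d m)) → tsubBs ρ (tsubBs ρ' bs) ≡ tsubBs (subT ρ ∘ ρ') bs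
  tsubBs-tsubBs ρ ρ' [] = refl
  tsubBs-tsubBs ρ ρ' (e ∷ bs) = cong₂ _∷_ (tsubTm-tsubTm ρ ρ' e) (tsubBs-tsubBs ρ ρ' bs)

tsub-wk : ∀ {d d' m} (ρ : Fin d → Ty d') (v : Val d m) → tsubV (extS ρ) (tyRenV suc v) ≡ tyRenV suc (tsubV ρ v)
tsub-wk ρ v =
  trans (cong (tsubV (extS ρ)) (tyRenV=tsubV suc v))
  (trans (tsubV-tsubV (extS ρ) _ v)
  (trans (tsubV-cong (λ i → renT=subT suc (ρ i)) v)
  (trans (sym (tsubV-tsubV _ ρ v)) (sym (tyRenV=tsubV suc (tsubV ρ v))))))

mutual
  tsubV-renV : ∀ {d d' m k} (ρ : Fin d → Ty d') (ξ : Fin m → Fin k) (v : Val d m) → tsubV ρ (renV ξ v) ≡ renV ξ (tsubV ρ v)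
  tsubV-renV ρ ξ (var i) = refl
  tsubV-renV ρ ξ unit = refl
  tsubV-renV ρ ξ (pair v w) = cong₂ pair (tsubV-renV ρ ξ v) (tsubV-renV ρ ξ w)
  tsubV-renV ρ ξ (lam e) = cong lam (tsubTm-renTm ρ (extR ξ) e)
  tsubV-renV ρ ξ (inj i v) = cong (inj i) (tsubV-renV ρ ξ v)
  tsubV-renV ρ ξ (tlam e) = cong tlam (tsubTm-renTm (extS ρ) ξ e)

  tsubTm-renTm : ∀ {d d' m k} (ρ : Fin d → Ty d') (ξ : Fin m → Fin k) (e : Tm d m) → tsubTm ρ (renTm ξ e) ≡ renTm ξ (tsubTm ρ e)
  tsubTm-renTm ρ ξ (val v) = cong val (tsubV-renV ρ ξ v)
  tsubTm-renTm ρ ξ ?? = refl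
  tsubTm-renTm ρ ξ (projL v) = cong projL (tsubV-renV ρ ξ v)
  tsubTm-renTm ρ ξ (projR v) = cong projR (tsubV-renV ρ ξ v)
  tsubTm-renTm ρ ξ (app v e) = cong₂ app (tsubV-renV ρ ξ v) (tsubTm-renTm ρ ξ e)
  tsubTm-renTm ρ ξ (case v bs) = cong₂ case (tsubV-renV ρ ξ v) (tsubBs-renBs ρ (extR ξ) bs)
  tsubTm-renTm ρ ξ (tapp v τ) = cong (λ x → tapp x (subT ρ τ)) (tsubV-renV ρ ξ v)

  tsubBs-renBs : ∀ {d d' m k} (ρ : Fin d → Ty d') (ξ : Fin m → Fin k) (bs : List (Tm d m)) → tsubBs ρ (renBs ξ bs) ≡ renBs ξ (tsubBs ρ bs)
  tsubBs-renBs ρ ξ [] = refl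
  tsubBs-renBs ρ ξ (e ∷ bs) = cong₂ _∷_ (tsubTm-renTm ρ ξ e) (tsubBs-renBs ρ ξ bs)

extsV-tsub : ∀ {d d' m k} (ρ : Fin d → Ty d') (σ : Fin m → Val d k) → ∀ i → tsubV ρ (extsV σ i) ≡ extsV (tsubV ρ ∘ σ) i
extsV-tsub ρ σ zero = refl
extsV-tsub ρ σ (suc i) = tsubV-renV ρ suc (σ i)

mutual
  tsubV-subV : ∀ {d d' m k} (ρ : Fin d → Ty d') (σ : Fin m → Val d k) (v : Val d m) → tsubV ρ (subV σ v) ≡ subV (tsubV ρ ∘ σ) (tsubV ρ v)
  tsubV-subV ρ σ (var i) = refl
  tsubV-subV ρ σ unit = refl
  tsubV-subV ρ σ (pair v w) = cong₂ pair (tsubV-subV ρ σ v) (tsubV-subV ρ σ w)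
  tsubV-subV ρ σ (lam e) = cong lam (trans (tsubTm-subTm ρ (extsV σ) e) (subTm-cong (extsV-tsub ρ σ) (tsubTm ρ e)))
  tsubV-subV ρ σ (inj i v) = cong (inj i) (tsubV-subV ρ σ v)
  tsubV-subV ρ σ (tlam e) = cong tlam (trans (tsubTm-subTm (extS ρ) _ e) (subTm-cong (λ i → tsub-wk ρ (σ i)) (tsubTm (extS ρ) e)))

  tsubTm-subTm : ∀ {d d' m k} (ρ : Fin d → Ty d') (σ : Fin m → Val d k) (e : Tm d m) → tsubTm ρ (subTm σ e) ≡ subTm (tsubV ρ ∘ σ) (tsubTm ρ e)
  tsubTm-subTm ρ σ (val v) = cong val (tsubV-subV ρ σ v)
  tsubTm-subTm ρ σ ?? = refl
  tsubTm-subTm ρ σ (projL v) = cong projL (tsubV-subV ρ σ v)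
  tsubTm-subTm ρ σ (projR v) = cong projR (tsubV-subV ρ σ v)
  tsubTm-subTm ρ σ (app v e) = cong₂ app (tsubV-subV ρ σ v) (tsubTm-subTm ρ σ e)
  tsubTm-subTm ρ σ (case v bs) = cong₂ case (tsubV-subV ρ σ v) (trans (tsubBs-subBs ρ (extsV σ) bs) (subBs-cong (extsV-tsub ρ σ) (tsubBs ρ bs)))
  tsubTm-subTm ρ σ (tapp v τ) = cong (λ x → tapp x (subT ρ τ)) (tsubV-subV ρ σ v)

  tsubBs-subBs : ∀ {d d' m k} (ρ : Fin d → Ty d') (σ : Fin m → Val d k) (bs : List (Tm d m)) → tsubBs ρ (subBs σ bs) ≡ subBs (tsubV ρ ∘ σ) (tsubBs ρ bs)
  tsubBs-subBs ρ σ [] = refl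
  tsubBs-subBs ρ σ (e ∷ bs) = cong₂ _∷_ (tsubTm-subTm ρ σ e) (tsubBs-subBs ρ σ bs)

tyRenV-subV : ∀ {d d' m k} (ξ : Fin d → Fin d') (σ : Fin m → Val d k) (v : Val d m) → tyRenV ξ (subV σ v) ≡ subV (tyRenV ξ ∘ σ) (tyRenV ξ v)
tyRenV-subV ξ σ v = trans (tyRenV=tsubV ξ (subV σ v)) (trans (tsubV-subV _ σ v)
   (sym (trans (subV-cong (λ i → tyRenV=tsubV ξ (σ i)) (tyRenV ξ v)) (cong (subV _) (tyRenV=tsubV ξ v)))))

extsV-sub : ∀ {d m k l} (σ : Fin k → Val d l) (τ : Fin m → Val d k) → ∀ i → subV (extsV σ) (extsV τ i) ≡ extsV (subV σ ∘ τ) i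
extsV-sub σ τ zero = refl
extsV-sub σ τ (suc i) = trans (subV-renV (extsV σ) suc (τ i)) (sym (renV-subV suc σ (τ i)))

mutual
  subV-subV : ∀ {d m k l} (σ : Fin k → Val d l) (τ : Fin m → Val d k) (v : Val d m) → subV σ (subV τ v) ≡ subV (subV σ ∘ τ) v
  subV-subV σ τ (var i) = refl
  subV-subV σ τ unit = refl
  subV-subV σ τ (pair v w) = cong₂ pair (subV-subV σ τ v) (subV-subV σ τ w)
  subV-subV σ τ (lam e) = cong lam (trans (subTm-subTm (extsV σ) (extsV τ) e) (subTm-cong (extsV-sub σ τ) e))
  subV-subV σ τ (inj i v) = cong (inj i) (subV-subV σ τ v)
  subV-subV σ τ (tlam e) = cong tlam (trans (subTm-subTm _ _ e) (subTm-cong (λ i → sym (tyRenV-subV suc σ (τ i))) e))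

  subTm-subTm : ∀ {d m k l} (σ : Fin k → Val d l) (τ : Fin m → Val d k) (e : Tm d m) → subTm σ (subTm τ e) ≡ subTm (subV σ ∘ τ) e
  subTm-subTm σ τ (val v) = cong val (subV-subV σ τ v)
  subTm-subTm σ τ ?? = refl
  subTm-subTm σ τ (projL v) = cong projL (subV-subV σ τ v)
  subTm-subTm σ τ (projR v) = cong projR (subV-subV σ τ v)
  subTm-subTm σ τ (app v e) = cong₂ app (subV-subV σ τ v) (subTm-subTm σ τ e)
  subTm-subTm σ τ (case v bs) = cong₂ case (subV-subV σ τ v) (trans (subBs-subBs (extsV σ) (extsV τ) bs) (subBs-cong (extsV-sub σ τ) bs))
  subTm-subTm σ τ (tapp v τ') = cong (λ x → tapp x τ') (subV-subV σ τ v)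

  subBs-subBs : ∀ {d m k l} (σ : Fin k → Val d l) (τ : Fin m → Val d k) (bs : List (Tm d m)) → subBs σ (subBs τ bs) ≡ subBs (subV σ ∘ τ) bs
  subBs-subBs σ τ [] = refl
  subBs-subBs σ τ (e ∷ bs) = cong₂ _∷_ (subTm-subTm σ τ e) (subBs-subBs σ τ bs)

sub1 : ∀ {d m} → Val d m → Fin (suc m) → Val d m
sub1 v zero = v
sub1 v (suc i) = var i

[]v-def : ∀ {d m} (e : Tm d (suc m)) (v : Val d m) → e [ v ]v ≡ subTm (sub1 v) e
[]v-def e v = subTm-cong (λ { zero → refl ; (suc i) → refl }) e

sub-[]v : ∀ {d m k} (σ : Fin m → Val d k) (e : Tm d (suc m)) (v : Val d m) → subTm σ (e [ v ]v) ≡ (subTm (extsV σ) e) [ subV σ v ]v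
sub-[]v σ e v = trans (cong (subTm σ) ([]v-def e v)) (trans (subTm-subTm σ (sub1 v) e)
  (sym (trans ([]v-def (subTm (extsV σ) e) (subV σ v)) (trans (subTm-subTm _ (extsV σ) e) (subTm-cong h e)))))
  where h : ∀ i → subV (sub1 (subV σ v)) (extsV σ i) ≡ subV σ (sub1 v i)
        h zero = refl
        h (suc i) = trans (subV-renV _ suc (σ i)) (subV-id (σ i))

ren-[]v : ∀ {d m k} (ρ : Fin m → Fin k) (e : Tm d (suc m)) (v : Val d m) → renTm ρ (e [ v ]v) ≡ (renTm (extR ρ) e) [ renV ρ v ]v
ren-[]v ρ e v = trans (cong (renTm ρ) ([]v-def e v)) (trans (renTm-subTm ρ (sub1 v) e)
  (sym (trans ([]v-def (renTm (extR ρ) e) (renV ρ v)) (trans (subTm-renTm _ (extR ρ) e) (subTm-cong h e)))))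
  where h : ∀ i → sub1 (renV ρ v) (extR ρ i) ≡ renV ρ (sub1 v i)
        h zero = refl
        h (suc i) = refl

tsub-[]v : ∀ {d d' m} (ρ : Fin d → Ty d') (e : Tm d (suc m)) (v : Val d m) → tsubTm ρ (e [ v ]v) ≡ (tsubTm ρ e) [ tsubV ρ v ]v
tsub-[]v ρ e v = trans (cong (tsubTm ρ) ([]v-def e v)) (trans (tsubTm-subTm ρ (sub1 v) e)
  (sym (trans ([]v-def (tsubTm ρ e) (tsubV ρ v)) (subTm-cong h (tsubTm ρ e)))))
  where h : ∀ i → sub1 (tsubV ρ v) i ≡ tsubV ρ (sub1 v i)
        h zero = refl
        h (suc i) = refl

subext-wk : ∀ {d m k} (σ : Fin m → Val d k) (v : Val d m) → subV (extsV σ) (renV suc v) ≡ renV suc (subV σ v)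
subext-wk σ v = trans (subV-renV (extsV σ) suc v) (sym (renV-subV suc σ v))

renext-wk : ∀ {d m k} (ρ : Fin m → Fin k) (v : Val d m) → renV (extR ρ) (renV suc v) ≡ renV suc (renV ρ v)
renext-wk ρ v = trans (renV-renV (extR ρ) suc v) (sym (renV-renV suc ρ v))

mutual
  renTyV : ∀ {d m k} {Γ : Ctx d m} {Δ : Ctx d k} (ρ : Fin m → Fin k) → (∀ i → lookup Δ (ρ i) ≡ lookup Γ i) →
           ∀ {v τ} → Γ ⊢v v ∶ τ → Δ ⊢v renV ρ v ∶ τ
  renTyV ρ h (⊢var i) = subst (λ t → _ ⊢v var (ρ i) ∶ t) (h i) (⊢var (ρ i))
  renTyV ρ h ⊢unit = ⊢unit
  renTyV ρ h (⊢pair a b) = ⊢pair (renTyV ρ h a) (renTyV ρ h b)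
  renTyV ρ h (⊢lam b) = ⊢lam (renTy (extR ρ) (λ { zero → refl ; (suc i) → h i }) b)
  renTyV ρ h (⊢inj n a) = ⊢inj n (renTyV ρ h a)
  renTyV {Γ = Γ} {Δ} ρ h (⊢tlam b) = ⊢tlam (renTy ρ h' b)
    where h' : ∀ i → lookup (wkCtx Δ) (ρ i) ≡ lookup (wkCtx Γ) i
          h' i = trans (lookup-map (ρ i) (renT suc) Δ) (trans (cong (renT suc) (h i)) (sym (lookup-map i (renT suc) Γ)))

  renTy : ∀ {d m k} {Γ : Ctx d m} {Δ : Ctx d k} (ρ : Fin m → Fin k) → (∀ i → lookup Δ (ρ i) ≡ lookup Γ i) →
           ∀ {e τ} → Γ ⊢ e ∶ τ → Δ ⊢ renTm ρ e ∶ τ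
  renTy ρ h (⊢val a) = ⊢val (renTyV ρ h a)
  renTy ρ h ⊢? = ⊢?
  renTy ρ h (⊢projL a) = ⊢projL (renTyV ρ h a)
  renTy ρ h (⊢projR a) = ⊢projR (renTyV ρ h a)
  renTy ρ h (⊢app a b) = ⊢app (renTyV ρ h a) (renTy ρ h b)
  renTy ρ h (⊢case a bs) = ⊢case (renTyV ρ h a) (renTyB ρ h bs)
  renTy ρ h (⊢tapp a σ) = ⊢tapp (renTyV ρ h a) σ

  renTyB : ∀ {d m k} {Γ : Ctx d m} {Δ : Ctx d k} (ρ : Fin m → Fin k) → (∀ i → lookup Δ (ρ i) ≡ lookup Γ i) →
           ∀ {r τs bs σ} → ⊢Branches Γ r τs bs σ → ⊢Branches Δ r τs (renBs (extR ρ) bs) σ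
  renTyB ρ h [] = []
  renTyB ρ h (b ∷ bs) = renTy (extR ρ) (λ { zero → refl ; (suc i) → h i }) b ∷ renTyB ρ h bs

wkTyV : ∀ {d m} {Γ : Ctx d m} {a v τ} → Γ ⊢v v ∶ τ → (a ∷ᵥ Γ) ⊢v renV suc v ∶ τ
wkTyV = renTyV suc (λ i → refl)

Nth-map : ∀ {n k} (ρ : Fin n → Ty k) {τs i σ} → Nth τs i σ → Nth (subTs ρ τs) i (subT ρ σ)
Nth-map ρ here = here
Nth-map ρ (there n) = there (Nth-map ρ n)

wk-map : ∀ {d d' m} (ρ : Fin d → Ty d') (Γ : Ctx d m) → mapᵥ (subT (extS ρ)) (wkCtx Γ) ≡ wkCtx (mapᵥ (subT ρ) Γ)
wk-map ρ Γ = trans (sym (map-∘ (subT (extS ρ)) (renT suc) Γ)) (trans (map-cong (wk-sub ρ) Γ) (map-∘ (renT suc) (subT ρ) Γ))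

mutual
  tsubTyV : ∀ {d d' m} {Γ : Ctx d m} (ρ : Fin d → Ty d') → ∀ {v τ} → Γ ⊢v v ∶ τ → mapᵥ (subT ρ) Γ ⊢v tsubV ρ v ∶ subT ρ τ
  tsubTyV {Γ = Γ} ρ (⊢var i) = subst (λ t → _ ⊢v var i ∶ t) (lookup-map i (subT ρ) Γ) (⊢var i)
  tsubTyV ρ ⊢unit = ⊢unit
  tsubTyV ρ (⊢pair a b) = ⊢pair (tsubTyV ρ a) (tsubTyV ρ b)
  tsubTyV ρ (⊢lam b) = ⊢lam (tsubTy ρ b)
  tsubTyV ρ (⊢inj {τ = τ} {τs} {σ} n a) = ⊢inj (Nth-map (extS ρ) n) (subst (λ t → _ ⊢v _ ∶ t) (sub-single ρ σ (μ τ τs)) (tsubTyV ρ a))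
  tsubTyV {Γ = Γ} ρ (⊢tlam b) = ⊢tlam (subst (λ G → G ⊢ _ ∶ _) (wk-map ρ Γ) (tsubTy (extS ρ) b))

  tsubTy : ∀ {d d' m} {Γ : Ctx d m} (ρ : Fin d → Ty d') → ∀ {e τ} → Γ ⊢ e ∶ τ → mapᵥ (subT ρ) Γ ⊢ tsubTm ρ e ∶ subT ρ τ
  tsubTy ρ (⊢val a) = ⊢val (tsubTyV ρ a)
  tsubTy ρ ⊢? = ⊢?
  tsubTy ρ (⊢projL a) = ⊢projL (tsubTyV ρ a)
  tsubTy ρ (⊢projR a) = ⊢projR (tsubTyV ρ a)
  tsubTy ρ (⊢app a b) = ⊢app (tsubTyV ρ a) (tsubTy ρ b)
  tsubTy ρ (⊢case a bs) = ⊢case (tsubTyV ρ a) (tsubTyB ρ bs)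
  tsubTy ρ (⊢tapp {τ = τ} a σ) = subst (λ t → _ ⊢ _ ∶ t) (sym (sub-single ρ τ σ)) (⊢tapp (tsubTyV ρ a) (subT ρ σ))

  tsubTyB : ∀ {d d' m} {Γ : Ctx d m} (ρ : Fin d → Ty d') → ∀ {r τs bs σ} → ⊢Branches Γ r τs bs σ →
            ⊢Branches (mapᵥ (subT ρ) Γ) (subT ρ r) (subTs (extS ρ) τs) (tsubBs ρ bs) (subT ρ σ)
  tsubTyB ρ [] = []
  tsubTyB {Γ = Γ} ρ {r} (_∷_ {τ = τ} b bs) = subst (λ t → (t ∷ᵥ mapᵥ (subT ρ) Γ) ⊢ _ ∶ _) (sub-single ρ τ r) (tsubTy ρ b) ∷ tsubTyB ρ bs

tyWkTyV : ∀ {d m} {Δ : Ctx d m} {v τ} → Δ ⊢v v ∶ τ → wkCtx Δ ⊢v tyRenV suc v ∶ renT suc τ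
tyWkTyV {Δ = Δ} {v} {τ} a = subst₂ (λ G t → G ⊢v _ ∶ t) (map-cong (λ x → sym (renT=subT suc x)) Δ) (sym (renT=subT suc τ))
   (subst (λ w → _ ⊢v w ∶ _) (sym (tyRenV=tsubV suc v)) (tsubTyV (`_ ∘ suc) a))

mutual
  subTyV : ∀ {d m k} {Γ : Ctx d m} {Δ : Ctx d k} (σ : Fin m → Val d k) → (∀ i → Δ ⊢v σ i ∶ lookup Γ i) →
           ∀ {v τ} → Γ ⊢v v ∶ τ → Δ ⊢v subV σ v ∶ τ
  subTyV σ h (⊢var i) = h i
  subTyV σ h ⊢unit = ⊢unit
  subTyV σ h (⊢pair a b) = ⊢pair (subTyV σ h a) (subTyV σ h b)
  subTyV σ h (⊢lam b) = ⊢lam (subTy (extsV σ) (λ { zero → ⊢var zero ; (suc i) → wkTyV (h i) }) b)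
  subTyV σ h (⊢inj n a) = ⊢inj n (subTyV σ h a)
  subTyV {Γ = Γ} {Δ} σ h (⊢tlam b) = ⊢tlam (subTy (tyRenV suc ∘ σ) h' b)
    where h' : ∀ i → wkCtx Δ ⊢v tyRenV suc (σ i) ∶ lookup (wkCtx Γ) i
          h' i = subst (λ t → _ ⊢v _ ∶ t) (sym (lookup-map i (renT suc) Γ)) (tyWkTyV (h i))

  subTy : ∀ {d m k} {Γ : Ctx d m} {Δ : Ctx d k} (σ : Fin m → Val d k) → (∀ i → Δ ⊢v σ i ∶ lookup Γ i) →
           ∀ {e τ} → Γ ⊢ e ∶ τ → Δ ⊢ subTm σ e ∶ τ
  subTy σ h (⊢val a) = ⊢val (subTyV σ h a)
  subTy σ h ⊢? = ⊢?
  subTy σ h (⊢projL a) = ⊢projL (subTyV σ h a)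
  subTy σ h (⊢projR a) = ⊢projR (subTyV σ h a)
  subTy σ h (⊢app a b) = ⊢app (subTyV σ h a) (subTy σ h b)
  subTy σ h (⊢case a bs) = ⊢case (subTyV σ h a) (subTyB σ h bs)
  subTy σ h (⊢tapp a s) = ⊢tapp (subTyV σ h a) s

  subTyB : ∀ {d m k} {Γ : Ctx d m} {Δ : Ctx d k} (σ : Fin m → Val d k) → (∀ i → Δ ⊢v σ i ∶ lookup Γ i) →
           ∀ {r τs bs s} → ⊢Branches Γ r τs bs s → ⊢Branches Δ r τs (subBs (extsV σ) bs) s
  subTyB σ h [] = []
  subTyB σ h (b ∷ bs) = subTy (extsV σ) (λ { zero → ⊢var zero ; (suc i) → wkTyV (h i) }) b ∷ subTyB σ h bs

single-ty : ∀ {d m} {Γ : Ctx d m} {a e τ v} → (a ∷ᵥ Γ) ⊢ e ∶ τ → Γ ⊢v v ∶ a → Γ ⊢ e [ v ]v ∶ τ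
single-ty {e = e} {v = v} b a = subst (λ t → _ ⊢ t ∶ _) (sym ([]v-def e v)) (subTy (sub1 v) (λ { zero → a ; (suc i) → ⊢var i }) b)

num-ty : ∀ {d m} {Γ : Ctx d m} n → Γ ⊢v num n ∶ nat
num-ty zero = ⊢inj here ⊢unit
num-ty (suc n) = ⊢inj (there here) (num-ty n)

branch-ty : ∀ {d m} {Γ : Ctx d m} {r τs bs s j τ e} → ⊢Branches Γ r τs bs s → Nth τs j τ → Nth bs j e → ((τ [ r ]T) ∷ᵥ Γ) ⊢ e ∶ s
branch-ty (b ∷ bs) here here = b
branch-ty (b ∷ bs) (there n) (there m) = branch-ty bs n m

tsub1-eq : ∀ {d m} (e : Tm (suc d) m) (σ : Ty d) → tsubTm (s1T σ) e ≡ e [ σ ]t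
tsub1-eq e σ = tsubTm-cong (λ { zero → refl ; (suc i) → refl }) e

wk-cancel : ∀ {d m} (Γ : Ctx d m) (σ : Ty d) → mapᵥ (subT (s1T σ)) (wkCtx Γ) ≡ Γ
wk-cancel []ᵥ σ = refl
wk-cancel (x ∷ᵥ Γ) σ = cong₂ _∷ᵥ_ (trans (subT-renT _ suc x) (subT-id x)) (wk-cancel Γ σ)

preserve : ∀ {d m} {Γ : Ctx d m} {e e' τ} → Γ ⊢ e ∶ τ → e ↦ e' → Γ ⊢ e' ∶ τ
preserve (⊢projL (⊢pair a b)) β-projL = ⊢val a
preserve (⊢projR (⊢pair a b)) β-projR = ⊢val b
preserve (⊢app (⊢lam b) (⊢val a)) β-lam = single-ty b a
preserve {Γ = Γ} (⊢tapp {τ = τ} (⊢tlam b) σ) (β-tlam {e = e}) =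
  subst₂ (λ G t → G ⊢ e [ σ ]t ∶ t) (wk-cancel Γ σ) (sym ([]T≡subT τ σ))
    (subst (λ x → _ ⊢ x ∶ _) (tsub1-eq e σ) (tsubTy (s1T σ) b))
preserve (⊢case (⊢inj n a) bs) (β-case m) = single-ty (branch-ty bs n m) a
preserve ⊢? (β-? n) = ⊢val (num-ty n)
preserve (⊢app a b) (ξ-app s) = ⊢app a (preserve b s)

canon-fun : ∀ {d} {v : Val d 0} {a b} → []ᵥ ⊢v v ∶ (a ⇒ b) → Σ (Tm d 1) λ e → v ≡ lam e
canon-fun {v = var ()} _
canon-fun {v = lam e} _ = e , refl
canon-fun {v = unit} ()
canon-fun {v = pair _ _} ()
canon-fun {v = inj _ _} ()
canon-fun {v = tlam _} ()

canon-2 : ∀ {d} {v : Val d 0} {a b} → []ᵥ ⊢v v ∶ μ a (b ∷ []) → (Σ (Val d 0) λ w → v ≡ inj zero w) ⊎ (Σ (Val d 0) λ w → v ≡ inj (suc zero) w)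
canon-2 {v = var ()} _
canon-2 {v = unit} ()
canon-2 {v = pair _ _} ()
canon-2 {v = lam _} ()
canon-2 {v = tlam _} ()
canon-2 {v = inj _ _} (⊢inj here a) = inj₁ (_ , refl)
canon-2 {v = inj _ _} (⊢inj (there here) a) = inj₂ (_ , refl)
canon-2 {v = inj _ _} (⊢inj (there (there ())) a)

-- Every step of the unfolding below is of this kind; they are the
-- "administrative" steps that the simulation may take on the left alone.
Det : ∀ {d m} → Tm d m → Tm d m → Set
Det e e₂ = ∀ {e₃} → e ↦ e₃ → e₃ ≡ e₂

_⟶_ : ∀ {d m} → Tm d m → Tm d m → Set
e ⟶ e₂ = (e ↦ e₂) × Det e e₂

val-no-step : ∀ {d m} {v : Val d m} {e} → val v ↦ e → ⊥
val-no-step ()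

Nth-unique : ∀ {A : Set} {xs : List A} {i x y} → Nth xs i x → Nth xs i y → x ≡ y
Nth-unique here here = refl
Nth-unique (there n) (there n') = Nth-unique n n'

β⟶ : ∀ {d m} {b : Tm d (suc m)} {a} → app (lam b) (val a) ⟶ (b [ a ]v)
β⟶ = β-lam , λ { β-lam → refl ; (ξ-app ()) }

tβ⟶ : ∀ {d m} {v : Val d m} {b τ} → app v (tapp (tlam b) τ) ⟶ app v (b [ τ ]t)
tβ⟶ = ξ-app β-tlam , λ { (ξ-app β-tlam) → refl }

case⟶ : ∀ {d m} {v : Val d m} {bs j b} → Nth bs j b → case (inj j v) bs ⟶ (b [ v ]v)
case⟶ n = β-case n , λ { (β-case n') → cong (λ b → b [ _ ]v) (Nth-unique n' n) }

ξ⟶ : ∀ {d m} {v : Val d m} {e e₂} → e ⟶ e₂ → app v e ⟶ app v e₂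
ξ⟶ {v = v} (st , det) = ξ-app st , det'
  where
  det' : Det (app v _) (app v _)
  det' (ξ-app st') = cong (app v) (det st')
  det' β-lam = ⊥-elim (val-no-step st)

⟶-≡ : ∀ {d m} {e e₂ e₃ : Tm d m} → e ⟶ e₂ → e₂ ≡ e₃ → e ⟶ e₃
⟶-≡ st refl = st

-- The terms of the statement and those met while running fix[τ][τ] f.
-- All are closed, but they are defined in every context because they may
-- occur under binders inside related terms.

I : ∀ {d m} → Val d m
I = lam (val (var zero))

fG : ∀ {d m} → Val d m
fG = lam (val (lam (case (var zero)
       ( val (inj zero (var zero))
       ∷ val (inj (suc zero) (lam
           (app (var (suc (suc (suc zero))))
                (app (var (suc zero))
                     (app (var (suc (suc (suc zero)))) (val (var zero)))))))
       ∷ []))))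

δG : ∀ {d m} → Val d (suc m)
δG =
  lam (case (var zero)
        (app (var (suc (suc zero)))
             (val (lam (app (lam (app (var zero) (val (var (suc zero)))))
                            (app (var (suc zero)) (val (var (suc (suc zero))))))))
         ∷ []))

fixVG : ∀ {d m} → Val d m
fixVG = tlam (val (tlam (val (lam (app δG (val (inj zero δG)))))))

τG : ∀ {d} → Ty d
τG = μ nat (((` zero) ⇒ (` zero)) ∷ [])

Dv : ∀ {d m} → Val d m
Dv = lam (case (var zero)
        (app fG
             (val (lam (app (lam (app (var zero) (val (var (suc zero)))))
                            (app (var (suc zero)) (val (var (suc (suc zero))))))))
         ∷ []))

-- H = λx. let r = D (in D) in r x: the recursive call that fix hands to f.
Hc : ∀ {d m} → Val d m
Hc = lam (app (lam (app (var zero) (val (var (suc zero))))) (app Dv (val (inj zero Dv))))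

-- F = f H = λx. case x of (in₁ y ⇒ in₁ y | in₂ g ⇒ in₂ (λy. H (g (H y)))).
bF2 : ∀ {d m} → Tm d (suc m)
bF2 = val (inj (suc zero) (lam (app Hc (app (var (suc zero)) (app Hc (val (var zero)))))))

bsF : ∀ {d m} → List (Tm d (suc m))
bsF = val (inj zero (var zero)) ∷ bF2 ∷ []

Fc : ∀ {d m} → Val d m
Fc = lam (case (var zero) bsF)

-- W g = λy. H (g (H y)): what F makes of the function g in in₂ g.
W : ∀ {d m} → Val d m → Val d m
W g = lam (app Hc (app (renV suc g) (app Hc (val (var zero)))))

-- Lv a = λr. r a: the continuation of a call H a waiting for r = F.
Lv : ∀ {d m} → Val d m → Val d m
Lv a = lam (app (var zero) (val (renV suc a)))

-- The run fix[τ][τ] f = run₀ ⟶ run₁ ⟶ … ⟶ run₇ ⟶ F, via the values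
-- Xv = fix[τ] and Yv = fix[τ][τ].  A call H a runs through run₅, run₆,
-- run₇ as well: H a ⟶ Lv a run₅ ⟶ … ⟶ Lv a F ⟶ F a.
Xv : ∀ {d m} → Val d m
Xv = tlam (val (lam (app δG (val (inj zero δG)))))

Yv : ∀ {d m} → Val d m
Yv = lam (app δG (val (inj zero δG)))

run₀ run₁ run₂ run₃ run₄ run₅ run₆ run₇ : ∀ {d m} → Tm d m
run₀ = app (lam (app (lam (app (var zero) (val fG))) (tapp (var zero) τG))) (tapp fixVG τG)
run₁ = app (lam (app (lam (app (var zero) (val fG))) (tapp (var zero) τG))) (val Xv)
run₂ = app (lam (app (var zero) (val fG))) (tapp Xv τG)
run₃ = app (lam (app (var zero) (val fG))) (val Yv)
run₄ = app Yv (val fG)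
run₅ = app Dv (val (inj zero Dv))
run₆ = case (inj zero Dv) (app fG (val (lam (app (lam (app (var zero) (val (var (suc zero))))) (app (var (suc zero)) (val (inj zero Dv)))))) ∷ [])
run₇ = app fG (val Hc)

Lv-F⟶ : ∀ (a : Val 0 0) → app (Lv a) (val Fc) ⟶ app Fc (val a)
Lv-F⟶ a = ⟶-≡ β⟶ (cong (λ z → app Fc (val z)) (trans (subV-renV _ suc a) (subV-id a)))

W⟶ : ∀ (g a : Val 0 0) → app (W g) (val a) ⟶ app Hc (app g (app Hc (val a)))
W⟶ g a = ⟶-≡ β⟶ (cong (λ z → app Hc (app z (app Hc (val a)))) (trans (subV-renV _ suc g) (subV-id g)))

-- Besides
-- the congruence rules it relates: F to id (s-F); W g to whatever g is
-- related to (s-wrap); each state of the run of fix[τ][τ] f to id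
-- (s-run₀ … s-run₇); each state of a call H a to a' when a ~ a'
-- (s-cont₅ … s-caseF); H e to e' when e ~ e' (s-H); and g e₁ to e[a] when
-- g ~ λx.e and e₁ ~ a (s-lag: the left side still owes the β-step that the
-- right side has already performed).  Equations l ≡ Lv a, w ≡ W g keep the
-- indices in pattern form.
mutual
  data SimV : ∀ {d m} → Val d m → Val d m → Set where
    s-var  : ∀ {d m} (i : Fin m) → SimV {d} (var i) (var i)
    s-unit : ∀ {d m} → SimV {d} {m} unit unit
    s-pair : ∀ {d m} {v v' w w' : Val d m} → SimV v v' → SimV w w' → SimV (pair v w) (pair v' w')
    s-lam  : ∀ {d m} {e e' : Tm d (suc m)} → Sim e e' → SimV (lam e) (lam e')
    s-inj  : ∀ {d m} {v v' : Val d m} (i : ℕ) → SimV v v' → SimV (inj i v) (inj i v')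
    s-tlam : ∀ {d m} {e e' : Tm (suc d) m} → Sim e e' → SimV (tlam e) (tlam e')
    s-F    : ∀ {d m} → SimV {d} {m} Fc I
    s-wrap    : ∀ {d m} {g w : Val d m} {e} → SimV g (lam e) → w ≡ W g → SimV w (lam e)

  data Sim : ∀ {d m} → Tm d m → Tm d m → Set where
    s-val   : ∀ {d m} {v v' : Val d m} → SimV v v' → Sim (val v) (val v')
    s-??    : ∀ {d m} → Sim {d} {m} ?? ??
    s-projL : ∀ {d m} {v v' : Val d m} → SimV v v' → Sim (projL v) (projL v')
    s-projR : ∀ {d m} {v v' : Val d m} → SimV v v' → Sim (projR v) (projR v')
    s-app   : ∀ {d m} {v v' : Val d m} {e e'} → SimV v v' → Sim e e' → Sim (app v e) (app v' e')
    s-case  : ∀ {d m} {v v' : Val d m} {bs bs'} → SimV v v' → SimBs bs bs' → Sim (case v bs) (case v' bs')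
    s-tapp  : ∀ {d m} {v v' : Val d m} → SimV v v' → (τ : Ty d) → Sim (tapp v τ) (tapp v' τ)
    s-run₀ : ∀ {d m} → Sim {d} {m} run₀ (val I)
    s-run₁ : ∀ {d m} → Sim {d} {m} run₁ (val I)
    s-run₂ : ∀ {d m} → Sim {d} {m} run₂ (val I)
    s-run₃ : ∀ {d m} → Sim {d} {m} run₃ (val I)
    s-run₄ : ∀ {d m} → Sim {d} {m} run₄ (val I)
    s-run₅ : ∀ {d m} → Sim {d} {m} run₅ (val I)
    s-run₆ : ∀ {d m} → Sim {d} {m} run₆ (val I)
    s-run₇ : ∀ {d m} → Sim {d} {m} run₇ (val I)
    s-cont₅ : ∀ {d m} {a a' l : Val d m} → SimV a a' → l ≡ Lv a → Sim (app l run₅) (val a')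
    s-cont₆ : ∀ {d m} {a a' l : Val d m} → SimV a a' → l ≡ Lv a → Sim (app l run₆) (val a')
    s-cont₇ : ∀ {d m} {a a' l : Val d m} → SimV a a' → l ≡ Lv a → Sim (app l run₇) (val a')
    s-contF : ∀ {d m} {a a' l : Val d m} → SimV a a' → l ≡ Lv a → Sim (app l (val Fc)) (val a')
    s-Fa : ∀ {d m} {a a' : Val d m} → SimV a a' → Sim (app Fc (val a)) (val a')
    s-caseF : ∀ {d m} {a a' : Val d m} → SimV a a' → Sim (case a bsF) (val a')
    s-H : ∀ {d m} {e e' : Tm d m} → Sim e e' → Sim (app Hc e) e'
    s-lag  : ∀ {d m} {g a : Val d m} {e e₁ e'} → SimV g (lam e) → Sim e₁ (val a) → e' ≡ e [ a ]v → Sim (app g e₁) e'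

  data SimBs : ∀ {d m} → List (Tm d m) → List (Tm d m) → Set where
    []  : ∀ {d m} → SimBs {d} {m} [] []
    _∷_ : ∀ {d m} {e e' : Tm d m} {bs bs'} → Sim e e' → SimBs bs bs' → SimBs (e ∷ bs) (e' ∷ bs')

-- The weight of a Sim-proof bounds the administrative steps the left side
-- takes before it is a value or steps in lockstep with the right side;
-- funWeight is the weight a related function contributes when the left
-- side finally applies it.  The constants follow the runs: a call H a needs
-- 7 steps (H a ⟶ Lv a run₅ ⟶ … ⟶ case a bsF ⟶ value), and W g a ⟶
-- H (g (H a)) of weight 7 + (7 + funWeight g) < 15 + funWeight g.
mutual
  weight : ∀ {d m} {e e' : Tm d m} → Sim e e' → ℕ
  weight (s-val _) = 0
  weight s-?? = 0
  weight (s-projL _) = 0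
  weight (s-projR _) = 0
  weight (s-app _ de) = weight de
  weight (s-case _ _) = 0
  weight (s-tapp _ _) = 0
  weight s-run₀ = 8
  weight s-run₁ = 7
  weight s-run₂ = 6
  weight s-run₃ = 5
  weight s-run₄ = 4
  weight s-run₅ = 3
  weight s-run₆ = 2
  weight s-run₇ = 1
  weight (s-cont₅ _ _) = 6
  weight (s-cont₆ _ _) = 5
  weight (s-cont₇ _ _) = 4
  weight (s-contF _ _) = 3
  weight (s-Fa _) = 2
  weight (s-caseF _) = 1
  weight (s-H de) = 7 + weight de
  weight (s-lag dg de _) = weight de + funWeight dg

  funWeight : ∀ {d m} {v v' : Val d m} → SimV v v' → ℕ
  funWeight (s-lam db) = suc (weight db)
  funWeight s-F = 2
  funWeight (s-wrap dg _) = 15 + funWeight dg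
  funWeight _ = 0

mutual
  reflSimV : ∀ {d m} (v : Val d m) → SimV v v
  reflSimV (var i) = s-var i
  reflSimV unit = s-unit
  reflSimV (pair v w) = s-pair (reflSimV v) (reflSimV w)
  reflSimV (lam e) = s-lam (reflSim e)
  reflSimV (inj i v) = s-inj i (reflSimV v)
  reflSimV (tlam e) = s-tlam (reflSim e)

  reflSim : ∀ {d m} (e : Tm d m) → Sim e e
  reflSim (val v) = s-val (reflSimV v)
  reflSim ?? = s-??
  reflSim (projL v) = s-projL (reflSimV v)
  reflSim (projR v) = s-projR (reflSimV v)
  reflSim (app v e) = s-app (reflSimV v) (reflSim e)
  reflSim (case v bs) = s-case (reflSimV v) (reflSimBs bs)
  reflSim (tapp v τ) = s-tapp (reflSimV v) τ

  reflSimBs : ∀ {d m} (bs : List (Tm d m)) → SimBs bs bs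
  reflSimBs [] = []
  reflSimBs (e ∷ bs) = reflSim e ∷ reflSimBs bs

Sim-val : ∀ {d m} {v : Val d m} {e'} → Sim (val v) e' → Σ (Val d m) λ v' → (e' ≡ val v') × SimV v v'
Sim-val (s-val a) = _ , refl , a

renW : ∀ {d m k} (ρ : Fin m → Fin k) (g : Val d m) → renV ρ (W g) ≡ W (renV ρ g)
renW ρ g = cong (λ z → lam (app Hc (app z (app Hc (val (var zero)))))) (renext-wk ρ g)

renL : ∀ {d m k} (ρ : Fin m → Fin k) (g : Val d m) → renV ρ (Lv g) ≡ Lv (renV ρ g)
renL ρ g = cong (λ z → lam (app (var zero) (val z))) (renext-wk ρ g)

mutual
  renSimV : ∀ {d m k} (ρ : Fin m → Fin k) {v v' : Val d m} → SimV v v' → SimV (renV ρ v) (renV ρ v')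
  renSimV ρ (s-var i) = s-var (ρ i)
  renSimV ρ s-unit = s-unit
  renSimV ρ (s-pair a b) = s-pair (renSimV ρ a) (renSimV ρ b)
  renSimV ρ (s-lam b) = s-lam (renSim (extR ρ) b)
  renSimV ρ (s-inj i a) = s-inj i (renSimV ρ a)
  renSimV ρ (s-tlam b) = s-tlam (renSim ρ b)
  renSimV ρ s-F = s-F
  renSimV ρ (s-wrap {g = g} dg refl) = s-wrap (renSimV ρ dg) (renW ρ g)

  renSim : ∀ {d m k} (ρ : Fin m → Fin k) {e e' : Tm d m} → Sim e e' → Sim (renTm ρ e) (renTm ρ e')
  renSim ρ (s-val a) = s-val (renSimV ρ a)
  renSim ρ s-?? = s-??
  renSim ρ (s-projL a) = s-projL (renSimV ρ a)
  renSim ρ (s-projR a) = s-projR (renSimV ρ a)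
  renSim ρ (s-app a b) = s-app (renSimV ρ a) (renSim ρ b)
  renSim ρ (s-case a bs) = s-case (renSimV ρ a) (renSimBs (extR ρ) bs)
  renSim ρ (s-tapp a τ) = s-tapp (renSimV ρ a) τ
  renSim ρ s-run₀ = s-run₀
  renSim ρ s-run₁ = s-run₁
  renSim ρ s-run₂ = s-run₂
  renSim ρ s-run₃ = s-run₃
  renSim ρ s-run₄ = s-run₄
  renSim ρ s-run₅ = s-run₅
  renSim ρ s-run₆ = s-run₆
  renSim ρ s-run₇ = s-run₇
  renSim ρ (s-cont₅ {a = a} da refl) = s-cont₅ (renSimV ρ da) (renL ρ a)
  renSim ρ (s-cont₆ {a = a} da refl) = s-cont₆ (renSimV ρ da) (renL ρ a)
  renSim ρ (s-cont₇ {a = a} da refl) = s-cont₇ (renSimV ρ da) (renL ρ a)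
  renSim ρ (s-contF {a = a} da refl) = s-contF (renSimV ρ da) (renL ρ a)
  renSim ρ (s-Fa da) = s-Fa (renSimV ρ da)
  renSim ρ (s-caseF da) = s-caseF (renSimV ρ da)
  renSim ρ (s-H de) = s-H (renSim ρ de)
  renSim ρ (s-lag {a = a} {e = e} dg de refl) = s-lag (renSimV ρ dg) (renSim ρ de) (ren-[]v ρ e a)

  renSimBs : ∀ {d m k} (ρ : Fin m → Fin k) {bs bs' : List (Tm d m)} → SimBs bs bs' → SimBs (renBs ρ bs) (renBs ρ bs')
  renSimBs ρ [] = []
  renSimBs ρ (b ∷ bs) = renSim ρ b ∷ renSimBs ρ bs

tsubW : ∀ {d d' m} (ρ : Fin d → Ty d') (g : Val d m) → tsubV ρ (W g) ≡ W (tsubV ρ g)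
tsubW ρ g = cong (λ z → lam (app Hc (app z (app Hc (val (var zero)))))) (tsubV-renV ρ suc g)

tsubL : ∀ {d d' m} (ρ : Fin d → Ty d') (g : Val d m) → tsubV ρ (Lv g) ≡ Lv (tsubV ρ g)
tsubL ρ g = cong (λ z → lam (app (var zero) (val z))) (tsubV-renV ρ suc g)

mutual
  tsubSimV : ∀ {d d' m} (ρ : Fin d → Ty d') {v v' : Val d m} → SimV v v' → SimV (tsubV ρ v) (tsubV ρ v')
  tsubSimV ρ (s-var i) = s-var i
  tsubSimV ρ s-unit = s-unit
  tsubSimV ρ (s-pair a b) = s-pair (tsubSimV ρ a) (tsubSimV ρ b)
  tsubSimV ρ (s-lam b) = s-lam (tsubSim ρ b)
  tsubSimV ρ (s-inj i a) = s-inj i (tsubSimV ρ a)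
  tsubSimV ρ (s-tlam b) = s-tlam (tsubSim (extS ρ) b)
  tsubSimV ρ s-F = s-F
  tsubSimV ρ (s-wrap {g = g} dg refl) = s-wrap (tsubSimV ρ dg) (tsubW ρ g)

  tsubSim : ∀ {d d' m} (ρ : Fin d → Ty d') {e e' : Tm d m} → Sim e e' → Sim (tsubTm ρ e) (tsubTm ρ e')
  tsubSim ρ (s-val a) = s-val (tsubSimV ρ a)
  tsubSim ρ s-?? = s-??
  tsubSim ρ (s-projL a) = s-projL (tsubSimV ρ a)
  tsubSim ρ (s-projR a) = s-projR (tsubSimV ρ a)
  tsubSim ρ (s-app a b) = s-app (tsubSimV ρ a) (tsubSim ρ b)
  tsubSim ρ (s-case a bs) = s-case (tsubSimV ρ a) (tsubSimBs ρ bs)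
  tsubSim ρ (s-tapp a τ) = s-tapp (tsubSimV ρ a) (subT ρ τ)
  tsubSim ρ s-run₀ = s-run₀
  tsubSim ρ s-run₁ = s-run₁
  tsubSim ρ s-run₂ = s-run₂
  tsubSim ρ s-run₃ = s-run₃
  tsubSim ρ s-run₄ = s-run₄
  tsubSim ρ s-run₅ = s-run₅
  tsubSim ρ s-run₆ = s-run₆
  tsubSim ρ s-run₇ = s-run₇
  tsubSim ρ (s-cont₅ {a = a} da refl) = s-cont₅ (tsubSimV ρ da) (tsubL ρ a)
  tsubSim ρ (s-cont₆ {a = a} da refl) = s-cont₆ (tsubSimV ρ da) (tsubL ρ a)
  tsubSim ρ (s-cont₇ {a = a} da refl) = s-cont₇ (tsubSimV ρ da) (tsubL ρ a)
  tsubSim ρ (s-contF {a = a} da refl) = s-contF (tsubSimV ρ da) (tsubL ρ a)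
  tsubSim ρ (s-Fa da) = s-Fa (tsubSimV ρ da)
  tsubSim ρ (s-caseF da) = s-caseF (tsubSimV ρ da)
  tsubSim ρ (s-H de) = s-H (tsubSim ρ de)
  tsubSim ρ (s-lag {a = a} {e = e} dg de refl) = s-lag (tsubSimV ρ dg) (tsubSim ρ de) (tsub-[]v ρ e a)

  tsubSimBs : ∀ {d d' m} (ρ : Fin d → Ty d') {bs bs' : List (Tm d m)} → SimBs bs bs' → SimBs (tsubBs ρ bs) (tsubBs ρ bs')
  tsubSimBs ρ [] = []
  tsubSimBs ρ (b ∷ bs) = tsubSim ρ b ∷ tsubSimBs ρ bs

tyWkSimV : ∀ {d m} {v v' : Val d m} → SimV v v' → SimV (tyRenV suc v) (tyRenV suc v')
tyWkSimV {v = v} {v'} a = subst₂ SimV (sym (tyRenV=tsubV suc v)) (sym (tyRenV=tsubV suc v')) (tsubSimV (`_ ∘ suc) a)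

subW : ∀ {d m k} (σ : Fin m → Val d k) (g : Val d m) → subV σ (W g) ≡ W (subV σ g)
subW σ g = cong (λ z → lam (app Hc (app z (app Hc (val (var zero)))))) (subext-wk σ g)

subL : ∀ {d m k} (σ : Fin m → Val d k) (g : Val d m) → subV σ (Lv g) ≡ Lv (subV σ g)
subL σ g = cong (λ z → lam (app (var zero) (val z))) (subext-wk σ g)

mutual
  subSimV : ∀ {d m k} (σ σ' : Fin m → Val d k) → (∀ i → SimV (σ i) (σ' i)) → {v v' : Val d m} → SimV v v' → SimV (subV σ v) (subV σ' v')
  subSimV σ σ' h (s-var i) = h i
  subSimV σ σ' h s-unit = s-unit
  subSimV σ σ' h (s-pair a b) = s-pair (subSimV σ σ' h a) (subSimV σ σ' h b)
  subSimV σ σ' h (s-lam b) = s-lam (subSim (extsV σ) (extsV σ') (λ { zero → s-var zero ; (suc i) → renSimV suc (h i) }) b)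
  subSimV σ σ' h (s-inj i a) = s-inj i (subSimV σ σ' h a)
  subSimV σ σ' h (s-tlam b) = s-tlam (subSim _ _ (λ i → tyWkSimV (h i)) b)
  subSimV σ σ' h s-F = s-F
  subSimV σ σ' h (s-wrap {g = g} dg refl) = s-wrap (subSimV σ σ' h dg) (subW σ g)

  subSim : ∀ {d m k} (σ σ' : Fin m → Val d k) → (∀ i → SimV (σ i) (σ' i)) → {e e' : Tm d m} → Sim e e' → Sim (subTm σ e) (subTm σ' e')
  subSim σ σ' h (s-val a) = s-val (subSimV σ σ' h a)
  subSim σ σ' h s-?? = s-??
  subSim σ σ' h (s-projL a) = s-projL (subSimV σ σ' h a)
  subSim σ σ' h (s-projR a) = s-projR (subSimV σ σ' h a)
  subSim σ σ' h (s-app a b) = s-app (subSimV σ σ' h a) (subSim σ σ' h b)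
  subSim σ σ' h (s-case a bs) = s-case (subSimV σ σ' h a) (subSimBs (extsV σ) (extsV σ') (λ { zero → s-var zero ; (suc i) → renSimV suc (h i) }) bs)
  subSim σ σ' h (s-tapp a τ) = s-tapp (subSimV σ σ' h a) τ
  subSim σ σ' h s-run₀ = s-run₀
  subSim σ σ' h s-run₁ = s-run₁
  subSim σ σ' h s-run₂ = s-run₂
  subSim σ σ' h s-run₃ = s-run₃
  subSim σ σ' h s-run₄ = s-run₄
  subSim σ σ' h s-run₅ = s-run₅
  subSim σ σ' h s-run₆ = s-run₆
  subSim σ σ' h s-run₇ = s-run₇
  subSim σ σ' h (s-cont₅ {a = a} da refl) = s-cont₅ (subSimV σ σ' h da) (subL σ a)
  subSim σ σ' h (s-cont₆ {a = a} da refl) = s-cont₆ (subSimV σ σ' h da) (subL σ a)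
  subSim σ σ' h (s-cont₇ {a = a} da refl) = s-cont₇ (subSimV σ σ' h da) (subL σ a)
  subSim σ σ' h (s-contF {a = a} da refl) = s-contF (subSimV σ σ' h da) (subL σ a)
  subSim σ σ' h (s-Fa da) = s-Fa (subSimV σ σ' h da)
  subSim σ σ' h (s-caseF da) = s-caseF (subSimV σ σ' h da)
  subSim σ σ' h (s-H de) = s-H (subSim σ σ' h de)
  subSim σ σ' h (s-lag {a = a} {e = e} dg de refl) = s-lag (subSimV σ σ' h dg) (subSim σ σ' h de) (sub-[]v σ' e a)

  subSimBs : ∀ {d m k} (σ σ' : Fin m → Val d k) → (∀ i → SimV (σ i) (σ' i)) → {bs bs' : List (Tm d m)} → SimBs bs bs' → SimBs (subBs σ bs) (subBs σ' bs')
  subSimBs σ σ' h [] = []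
  subSimBs σ σ' h (b ∷ bs) = subSim σ σ' h b ∷ subSimBs σ σ' h bs

mutual
  weight-subSim : ∀ {d m k} (σ σ' : Fin m → Val d k) (h : ∀ i → SimV (σ i) (σ' i)) {e e' : Tm d m} (x : Sim e e') → weight (subSim σ σ' h x) ≡ weight x
  weight-subSim σ σ' h (s-val a) = refl
  weight-subSim σ σ' h s-?? = refl
  weight-subSim σ σ' h (s-projL a) = refl
  weight-subSim σ σ' h (s-projR a) = refl
  weight-subSim σ σ' h (s-app a b) = weight-subSim σ σ' h b
  weight-subSim σ σ' h (s-case a bs) = refl
  weight-subSim σ σ' h (s-tapp a τ) = refl
  weight-subSim σ σ' h s-run₀ = refl
  weight-subSim σ σ' h s-run₁ = refl
  weight-subSim σ σ' h s-run₂ = refl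
  weight-subSim σ σ' h s-run₃ = refl
  weight-subSim σ σ' h s-run₄ = refl
  weight-subSim σ σ' h s-run₅ = refl
  weight-subSim σ σ' h s-run₆ = refl
  weight-subSim σ σ' h s-run₇ = refl
  weight-subSim σ σ' h (s-cont₅ da refl) = refl
  weight-subSim σ σ' h (s-cont₆ da refl) = refl
  weight-subSim σ σ' h (s-cont₇ da refl) = refl
  weight-subSim σ σ' h (s-contF da refl) = refl
  weight-subSim σ σ' h (s-Fa da) = refl
  weight-subSim σ σ' h (s-caseF da) = refl
  weight-subSim σ σ' h (s-H de) = cong (7 +_) (weight-subSim σ σ' h de)
  weight-subSim σ σ' h (s-lag dg de refl) = cong₂ _+_ (weight-subSim σ σ' h de) (funWeight-subSimV σ σ' h dg)

  funWeight-subSimV : ∀ {d m k} (σ σ' : Fin m → Val d k) (h : ∀ i → SimV (σ i) (σ' i)) {v : Val d m} {e} (x : SimV v (lam e)) → funWeight (subSimV σ σ' h x) ≡ funWeight x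
  funWeight-subSimV σ σ' h (s-lam b) = cong suc (weight-subSim _ _ _ b)
  funWeight-subSimV σ σ' h s-F = refl
  funWeight-subSimV σ σ' h (s-wrap dg refl) = cong (15 +_) (funWeight-subSimV σ σ' h dg)

CTm : Set
CTm = Tm 0 0

Forth : CTm → CTm → Set
Forth e e' = ∀ {e₃} → e ↦ e₃ → Σ CTm λ e'' → (e' ↦ e'') × Sim e₃ e''

Back : CTm → CTm → Set
Back e e' = ∀ {e''} → e' ↦ e'' → Σ CTm λ e₃ → (e ↦ e₃) × Sim e₃ e''

data Progress {e e' : CTm} (x : Sim e e') : Set where
  value    : ∀ {v} → e ≡ val v → Progress x
  admin    : ∀ {e₂} → e ⟶ e₂ → (y : Sim e₂ e') → weight y < weight x → Progress x
  lockstep : ∀ {e₂} → e ↦ e₂ → Forth e e' → Back e e' → Progress x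

lockstep⟶ : ∀ {e e' e₂ e₂' : CTm} {x : Sim e e'} → e ⟶ e₂ → e' ⟶ e₂' → Sim e₂ e₂' → Progress x
lockstep⟶ {e₂ = e₂} {e₂'} (st , det) (st' , det') y =
  lockstep st (λ s → e₂' , st' , subst (λ z → Sim z e₂') (sym (det s)) y)
              (λ s → e₂ , st , subst (Sim e₂) (sym (det' s)) y)

projL⟶ : ∀ {v w : Val 0 0} → projL (pair v w) ⟶ val v
projL⟶ = β-projL , λ { β-projL → refl }

projR⟶ : ∀ {v w : Val 0 0} → projR (pair v w) ⟶ val w
projR⟶ = β-projR , λ { β-projR → refl }

tlam⟶ : ∀ {b : Tm 1 0} {τ} → tapp (tlam b) τ ⟶ (b [ τ ]t)
tlam⟶ = β-tlam , λ { β-tlam → refl }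

SimV-lam : ∀ {b : Tm 0 1} {g'} → SimV (lam b) g' → Σ (Tm 0 1) λ e → g' ≡ lam e
SimV-lam (s-lam _) = _ , refl
SimV-lam s-F = _ , refl
SimV-lam (s-wrap _ _) = _ , refl

sub1Sim : ∀ {b b' : Tm 0 1} {w w' : Val 0 0} → Sim b b' → SimV w w' → Sim (b [ w ]v) (b' [ w' ]v)
sub1Sim {b} {b'} {w} {w'} db dw = subst₂ Sim (sym ([]v-def b w)) (sym ([]v-def b' w'))
  (subSim (sub1 w) (sub1 w') (λ { zero → dw ; (suc ()) }) db)

weight-subst₂ : ∀ {e₁ e₂ e₁' e₂' : CTm} (p : e₁ ≡ e₁') (q : e₂ ≡ e₂') (y : Sim e₁ e₂) → weight (subst₂ Sim p q y) ≡ weight y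
weight-subst₂ refl refl y = refl

weight-sub1Sim : ∀ {b b' : Tm 0 1} {w w' : Val 0 0} (db : Sim b b') (dw : SimV w w') → weight (sub1Sim db dw) ≡ weight db
weight-sub1Sim {b} {b'} {w} {w'} db dw = trans (weight-subst₂ (sym ([]v-def b w)) (sym ([]v-def b' w')) _) (weight-subSim _ _ _ db)

tsub1Sim : ∀ {b b' : Tm 1 0} (τ : Ty 0) → Sim b b' → Sim (b [ τ ]t) (b' [ τ ]t)
tsub1Sim {b} {b'} τ db = subst₂ Sim (tsub1-eq b τ) (tsub1-eq b' τ) (tsubSim (s1T τ) db)

nthB : ∀ {Γ : Ctx 0 0} {r τs bs s j σ} → ⊢Branches Γ r τs bs s → Nth τs j σ → Σ (Tm 0 1) λ b → Nth bs j b
nthB (t ∷ ts) here = _ , here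
nthB (t ∷ ts) (there n) with nthB ts n
... | b , nb = b , there nb

fwdB : ∀ {bs bs' : List (Tm 0 1)} {j b} → SimBs bs bs' → Nth bs j b → Σ (Tm 0 1) λ b' → Nth bs' j b' × Sim b b'
fwdB (x ∷ xs) here = _ , here , x
fwdB (x ∷ xs) (there n) with fwdB xs n
... | b' , n' , y = b' , there n' , y

progress-projL : ∀ {v v' : Val 0 0} {a b} → []ᵥ ⊢v v ∶ (a ⊗ b) → (dv : SimV v v') → Progress (s-projL dv)
progress-projL _ (s-pair dv dw) = lockstep⟶ projL⟶ projL⟶ (s-val dv)
progress-projL _ (s-var ())
progress-projL () s-unit
progress-projL () (s-lam _)
progress-projL () (s-inj _ _)
progress-projL () (s-tlam _)
progress-projL () s-F
progress-projL () (s-wrap _ refl)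

progress-projR : ∀ {v v' : Val 0 0} {a b} → []ᵥ ⊢v v ∶ (a ⊗ b) → (dv : SimV v v') → Progress (s-projR dv)
progress-projR _ (s-pair dv dw) = lockstep⟶ projR⟶ projR⟶ (s-val dw)
progress-projR _ (s-var ())
progress-projR () s-unit
progress-projR () (s-lam _)
progress-projR () (s-inj _ _)
progress-projR () (s-tlam _)
progress-projR () s-F
progress-projR () (s-wrap _ refl)

progress-tapp : ∀ {v v' : Val 0 0} {τ} → []ᵥ ⊢v v ∶ ∀' τ → (dv : SimV v v') (σ : Ty 0) → Progress (s-tapp dv σ)
progress-tapp _ (s-tlam db) σ = lockstep⟶ tlam⟶ tlam⟶ (tsub1Sim σ db)
progress-tapp _ (s-var ()) _
progress-tapp () s-unit _
progress-tapp () (s-pair _ _) _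
progress-tapp () (s-lam _) _
progress-tapp () (s-inj _ _) _
progress-tapp () s-F _
progress-tapp () (s-wrap _ refl) _

progress-case : ∀ {v v' : Val 0 0} {τ τs bs bs' σ} → []ᵥ ⊢v v ∶ μ τ τs → ⊢Branches []ᵥ (μ τ τs) (τ ∷ τs) bs σ →
                (dv : SimV v v') (dbs : SimBs bs bs') → Progress (s-case dv dbs)
progress-case (⊢inj n tw) tbs (s-inj j dw) dbs with nthB tbs n
... | b , nb with fwdB dbs nb
... | b' , nb' , db = lockstep⟶ (case⟶ nb) (case⟶ nb') (sub1Sim db dw)
progress-case _ _ (s-var ()) _
progress-case () _ s-unit _
progress-case () _ (s-pair _ _) _
progress-case () _ (s-lam _) _
progress-case () _ (s-tlam _) _
progress-case () _ s-F _
progress-case () _ (s-wrap _ refl) _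

-- The variable bound in the second branch of F is applied, so it has a
-- function type.
-- (Typing inversions are stated separately because the type indices of the
-- derivation are not in pattern form.)
lamInv : ∀ {Γ : Ctx 0 1} {e τ} → Γ ⊢v lam e ∶ τ → Σ (Ty 0) λ a → Σ (Ty 0) λ b → (τ ≡ a ⇒ b) × ((a ∷ᵥ Γ) ⊢ e ∶ b)
lamInv (⊢lam t) = _ , _ , refl , t

appInv : ∀ {m} {Γ : Ctx 0 m} {v e B} → Γ ⊢ app v e ∶ B → Σ (Ty 0) λ A → (Γ ⊢v v ∶ (A ⇒ B)) × (Γ ⊢ e ∶ A)
appInv (⊢app a b) = _ , a , b

varTy : ∀ {m} {Γ : Ctx 0 m} {i τ} → Γ ⊢v var i ∶ τ → lookup Γ i ≡ τ
varTy (⊢var i) = refl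

bF2-fun : ∀ {A₀ σ : Ty 0} → (A₀ ∷ᵥ []ᵥ) ⊢ bF2 ∶ σ → Σ (Ty 0) λ A → Σ (Ty 0) λ B → A₀ ≡ A ⇒ B
bF2-fun (⊢val (⊢inj _ tl)) with lamInv tl
... | _ , _ , _ , tb with appInv tb
... | _ , _ , tg with appInv tg
... | _ , tvar , _ = _ , _ , varTy tvar

-- The last step of a call, case a bsF: in₁ y gives in₁ y, and in₂ g gives
-- in₂ (W g), which is related to what g is related to.
progress-caseF : ∀ {a a' : Val 0 0} {τ} → []ᵥ ⊢ case a bsF ∶ τ → (dA : SimV a a') → Progress (s-caseF dA)
progress-caseF (⊢case ta (t1 ∷ t2 ∷ [])) dA with canon-2 ta
progress-caseF (⊢case ta (t1 ∷ t2 ∷ [])) (s-inj .zero dy) | inj₁ (y , refl) =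
  admin (case⟶ here) (s-val (s-inj zero dy)) (s≤s z≤n)
progress-caseF (⊢case (⊢inj (there here) tg) (t1 ∷ t2 ∷ [])) (s-inj .(suc zero) dg) | inj₂ (g , refl)
  with bF2-fun t2
... | A , B , eqA with canon-fun (subst (λ t → []ᵥ ⊢v g ∶ t) eqA tg)
... | b , refl with SimV-lam dg
... | e , refl = admin (case⟶ (there here)) (s-val (s-inj (suc zero) (s-wrap dg refl))) (s≤s z≤n)

forth-app : ∀ {v v' : Val 0 0} {e₁ e' e₂} → SimV v v' → e₁ ↦ e₂ → Forth e₁ e' → Forth (app v e₁) (app v' e')
forth-app da st fw (ξ-app s') with fw s'
... | e'' , st' , y = _ , ξ-app st' , s-app da y
forth-app da () fw β-lam

back-app : ∀ {v v' : Val 0 0} {e₁ e' e₂} → SimV v v' → e₁ ↦ e₂ → Forth e₁ e' → Back e₁ e' → Back (app v e₁) (app v' e')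
back-app da st fw bw (ξ-app s') with bw s'
... | e₃ , st' , y = _ , ξ-app st' , s-app da y
back-app da st fw bw β-lam = ⊥-elim (val-no-step (proj₁ (proj₂ (fw st))))

forth-H : ∀ {e₁ e' e₂ : CTm} → e₁ ↦ e₂ → Forth e₁ e' → Forth (app Hc e₁) e'
forth-H st fw (ξ-app s') with fw s'
... | e'' , st' , y = _ , st' , s-H y
forth-H () fw β-lam

back-H : ∀ {e₁ e' : CTm} → Back e₁ e' → Back (app Hc e₁) e'
back-H bw s' with bw s'
... | e₃ , st' , y = _ , ξ-app st' , s-H y

-- Application of related values: both sides β-reduce in lockstep.  For
-- F ~ id the left lands in case a bsF; for W g ~ λx.e it lands in
-- H (g (H a)), a lagging application under two calls.
progress-β : ∀ {v v' a a' : Val 0 0} {A B} → []ᵥ ⊢v v ∶ (A ⇒ B) → (da : SimV v v') → (dA : SimV a a') →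
             Progress (s-app da (s-val dA))
progress-β tv da dA with canon-fun tv
progress-β tv (s-lam db) dA | b , refl = lockstep⟶ β⟶ β⟶ (sub1Sim db dA)
progress-β tv s-F dA | b , refl = lockstep⟶ β⟶ β⟶ (s-caseF dA)
progress-β {a = a} tv (s-wrap {g = g} dg refl) dA | b , refl =
  lockstep⟶ (W⟶ g a) β⟶ (s-H (s-lag dg (s-H (s-val dA)) refl))

progress-app : ∀ {v v' : Val 0 0} {A B e₁ e'} → []ᵥ ⊢v v ∶ (A ⇒ B) → (da : SimV v v') → (de : Sim e₁ e') →
               Progress de → Progress (s-app da de)
progress-app tv da (s-val dA) (value refl) = progress-β tv da dA
progress-app tv da de (admin st y lt) = admin (ξ⟶ st) (s-app da y) lt
progress-app tv da de (lockstep st fw bw) = lockstep (ξ-app st) (forth-app da st fw) (back-app da st fw bw)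

-- H a starts the deterministic run of a call; otherwise H e follows e.
progress-H : ∀ {e₁ e' : CTm} → (de : Sim e₁ e') → Progress de → Progress (s-H de)
progress-H (s-val dA) (value refl) = admin β⟶ (s-cont₅ dA refl) ≤-refl
progress-H de (admin st y lt) = admin (ξ⟶ st) (s-H y) (+-monoʳ-< 7 lt)
progress-H de (lockstep st fw bw) = lockstep (ξ-app st) (forth-H st fw) (back-H bw)

-- A lagging application g a catches up with its β-step administratively;
-- before that its argument evaluates alone (the right side is a value).
progress-lagβ : ∀ {g a₁ a : Val 0 0} {e e'} → (dg : SimV g (lam e)) → (dA : SimV a₁ a) → (eq : e' ≡ e [ a ]v) →
                Progress (s-lag dg (s-val dA) eq)
progress-lagβ (s-lam db) dA refl = admin β⟶ (sub1Sim db dA) (subst (_< suc (weight db)) (sym (weight-sub1Sim db dA)) ≤-refl)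
progress-lagβ s-F dA refl = admin β⟶ (s-caseF dA) ≤-refl
progress-lagβ {a₁ = a₁} (s-wrap {g = g} dg refl) dA eq = admin (W⟶ g a₁) (s-H (s-lag dg (s-H (s-val dA)) eq)) ≤-refl

progress-lag : ∀ {g a : Val 0 0} {e e₁ e'} → (dg : SimV g (lam e)) → (de : Sim e₁ (val a)) → (eq : e' ≡ e [ a ]v) →
               Progress de → Progress (s-lag dg de eq)
progress-lag dg (s-val dA) eq (value refl) = progress-lagβ dg dA eq
progress-lag dg de eq (admin st y lt) = admin (ξ⟶ st) (s-lag dg y eq) (+-monoˡ-< (funWeight dg) lt)
progress-lag dg de eq (lockstep st fw bw) = ⊥-elim (val-no-step (proj₁ (proj₂ (fw st))))

progress : ∀ {e e' : CTm} {τ} → []ᵥ ⊢ e ∶ τ → (x : Sim e e') → Progress x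
progress _ (s-val _) = value refl
progress _ s-?? = lockstep (β-? 0) (λ { (β-? n) → _ , β-? n , reflSim _ }) (λ { (β-? n) → _ , β-? n , reflSim _ })
progress (⊢projL tv) (s-projL dv) = progress-projL tv dv
progress (⊢projR tv) (s-projR dv) = progress-projR tv dv
progress (⊢tapp tv _) (s-tapp dv σ) = progress-tapp tv dv σ
progress (⊢case tv tbs) (s-case dv dbs) = progress-case tv tbs dv dbs
progress (⊢app tv te) (s-app da de) = progress-app tv da de (progress te de)
progress (⊢app _ te) (s-H de) = progress-H de (progress te de)
progress (⊢app _ te) (s-lag dg de eq) = progress-lag dg de eq (progress te de)
progress _ s-run₀ = admin tβ⟶ s-run₁ ≤-refl
progress _ s-run₁ = admin β⟶ s-run₂ ≤-refl
progress _ s-run₂ = admin tβ⟶ s-run₃ ≤-refl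
progress _ s-run₃ = admin β⟶ s-run₄ ≤-refl
progress _ s-run₄ = admin β⟶ s-run₅ ≤-refl
progress _ s-run₅ = admin β⟶ s-run₆ ≤-refl
progress _ s-run₆ = admin (case⟶ here) s-run₇ ≤-refl
progress _ s-run₇ = admin β⟶ (s-val s-F) ≤-refl
progress _ (s-cont₅ dA refl) = admin (ξ⟶ β⟶) (s-cont₆ dA refl) ≤-refl
progress _ (s-cont₆ dA refl) = admin (ξ⟶ (case⟶ here)) (s-cont₇ dA refl) ≤-refl
progress _ (s-cont₇ dA refl) = admin (ξ⟶ β⟶) (s-contF dA refl) ≤-refl
progress _ (s-contF {a = a} dA refl) = admin (Lv-F⟶ a) (s-Fa dA) ≤-refl
progress _ (s-Fa dA) = admin β⟶ (s-caseF dA) ≤-refl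
progress T (s-caseF dA) = progress-caseF T dA

-- Forward directions follow reductions of
-- e; backward ones follow reductions of e', using the weight to bound the
-- administrative steps that e takes on its own.

may-forth : ∀ {e e' : CTm} {τ v} → []ᵥ ⊢ e ∶ τ → Sim e e' → e ↦* val v → e' ↓
may-forth T x done with Sim-val x
... | v' , refl , _ = v' , done
may-forth T x (step s rest) with progress T x
... | value refl = ⊥-elim (val-no-step s)
... | admin (st , det) y lt with det s
...   | refl = may-forth (preserve T st) y rest
may-forth T x (step s rest) | lockstep st fw bw with fw s
... | e'' , st' , y with may-forth (preserve T s) y rest
... | w , p = w , step st' p

may-back-acc : ∀ {e e' : CTm} {τ v'} → []ᵥ ⊢ e ∶ τ → (x : Sim e e') → e' ↦* val v' → Acc _<_ (weight x) → e ↓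
may-back-acc T x path (acc rs) with progress T x
... | value refl = _ , done
... | admin (st , _) y lt with may-back-acc (preserve T st) y path (rs lt)
...   | w , p = w , step st p
may-back-acc T x done (acc rs) | lockstep st fw bw = ⊥-elim (val-no-step (proj₁ (proj₂ (fw st))))
may-back-acc T x (step s' rest) (acc rs) | lockstep st fw bw with bw s'
... | e₃ , st₃ , y with may-back-acc (preserve T st₃) y rest (<-wellFounded (weight y))
... | w , p = w , step st₃ p

may-back : ∀ {e e' : CTm} {τ} → []ᵥ ⊢ e ∶ τ → Sim e e' → e' ↓ → e ↓
may-back T x (v' , path) = may-back-acc T x path (<-wellFounded (weight x))

diverges : ∀ {S : Set} (term : S → CTm) → (∀ s → Σ S λ s' → term s ↦ term s') → ∀ s₀ → term s₀ ⇓ → ⊥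
diverges {S} term next s₀ h = h (term ∘ states , refl , λ n → proj₂ (next (states n)))
  where
  states : ℕ → S
  states zero = s₀
  states (suc n) = proj₁ (next (states n))

-- If e' has an infinite reduction sequence s', so has e: the states are
-- terms l related to some s' k, and l always has a step (administrative,
-- or in lockstep with s' k ↦ s' (suc k)).
module ForthDivergence {τ : Ty 0} (s' : ℕ → CTm) (steps : ∀ n → s' n ↦ s' (suc n)) where
  record State : Set where
    constructor state
    field
      k : ℕ
      l : CTm
      T : []ᵥ ⊢ l ∶ τ
      x : Sim l (s' k)

  next : (S : State) → Σ State λ S' → State.l S ↦ State.l S'
  next (state k l T x) with progress T x
  ... | value refl with Sim-val x
  ...   | _ , eq , _ = ⊥-elim (val-no-step (subst (λ z → z ↦ s' (suc k)) eq (steps k)))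
  next (state k l T x) | admin (s , _) y lt = state k _ (preserve T s) y , s
  next (state k l T x) | lockstep s fw bw with bw (steps k)
  ... | e₃ , s₃ , y = state (suc k) e₃ (preserve T s₃) y , s₃

must-forth : ∀ {e e' : CTm} {τ} → []ᵥ ⊢ e ∶ τ → Sim e e' → e ⇓ → e' ⇓
must-forth {e} {τ = τ} T x h (s' , refl , steps) = diverges State.l next (state zero e T x) h
  where open ForthDivergence {τ} s' steps

weight-substL : ∀ {e₁ e₂ r : CTm} (p : e₁ ≡ e₂) (y : Sim e₁ r) → weight (subst (λ z → Sim z r) p y) ≡ weight y
weight-substL refl y = refl

-- If e has an infinite reduction sequence s, so has e': the states are
-- terms r with s k related to r; by well-founded induction on the weight,
-- s catches up administratively until a lockstep step moves r.
module BackDivergence {τ : Ty 0} (s : ℕ → CTm) (steps : ∀ n → s n ↦ s (suc n)) where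
  record State : Set where
    constructor state
    field
      k : ℕ
      r : CTm
      T : []ᵥ ⊢ s k ∶ τ
      x : Sim (s k) r

  advance : ∀ k r (T : []ᵥ ⊢ s k ∶ τ) (x : Sim (s k) r) → Acc _<_ (weight x) → Σ State λ S' → r ↦ State.r S'
  advance k r T x (acc rs) with progress T x
  ... | value eq = ⊥-elim (val-no-step (subst (λ z → z ↦ s (suc k)) eq (steps k)))
  ... | admin (_ , det) y lt =
        advance (suc k) r (preserve T (steps k)) (subst (λ z → Sim z r) (sym (det (steps k))) y)
                (rs (subst (_< weight x) (sym (weight-substL (sym (det (steps k))) y)) lt))
  ... | lockstep _ fw bw with fw (steps k)
  ...   | r'' , s'' , y = state (suc k) r'' (preserve T (steps k)) y , s''

  next : (S : State) → Σ State λ S' → State.r S ↦ State.r S'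
  next (state k r T x) = advance k r T x (<-wellFounded (weight x))

must-back : ∀ {e e' : CTm} {τ} → []ᵥ ⊢ e ∶ τ → Sim e e' → e' ⇓ → e ⇓
must-back {e' = e'} {τ} T x h (s , refl , steps) = diverges State.r next (state zero e' T x) h
  where open BackDivergence {τ} s steps

Rec : Ty 2
Rec = μ ((` zero) ⇒ ((` (suc (suc zero))) ⇒ (` (suc zero)))) []

Fty : Ty 2
Fty = ((` (suc zero)) ⇒ (` zero)) ⇒ ((` (suc zero)) ⇒ (` zero))

tδ : (Fty ∷ᵥ []ᵥ) ⊢v δ-fix ∶ (Rec ⇒ ((` (suc zero)) ⇒ (` zero)))
tδ = ⊢lam (⊢case (⊢var zero)
        (⊢app (⊢var (suc (suc zero)))
           (⊢val (⊢lam (⊢app (⊢lam (⊢app (⊢var zero) (⊢val (⊢var (suc zero)))))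
                             (⊢app (⊢var (suc zero)) (⊢val (⊢var (suc (suc zero))))))))
        ∷ []))

tfixV : []ᵥ ⊢v fixV ∶ ∀' (∀' (Fty ⇒ ((` (suc zero)) ⇒ (` zero))))
tfixV = ⊢tlam (⊢val (⊢tlam (⊢val (⊢lam (⊢app tδ (⊢val (⊢inj here tδ)))))))

tfV : ∀ {m} {Γ : Ctx 0 m} → Γ ⊢v fV ∶ ((τ₀ ⇒ τ₀) ⇒ (τ₀ ⇒ τ₀))
tfV = ⊢lam (⊢val (⊢lam (⊢case (⊢var zero)
        ( ⊢val (⊢inj here (⊢var zero))
        ∷ ⊢val (⊢inj (there here) (⊢lam
            (⊢app (⊢var (suc (suc (suc zero))))
                  (⊢app (⊢var (suc zero))
                        (⊢app (⊢var (suc (suc (suc zero)))) (⊢val (⊢var zero)))))))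
        ∷ []))))

tFix : []ᵥ ⊢ fixττf ∶ (τ₀ ⇒ τ₀)
tFix = ⊢app (⊢lam (⊢app (⊢lam (⊢app (⊢var zero) (⊢val tfV))) (⊢tapp (⊢var zero) τ₀))) (⊢tapp tfixV τ₀)

tId : []ᵥ ⊢ idTm ∶ (τ₀ ⇒ τ₀)
tId = ⊢val (⊢lam (⊢val (⊢var zero)))

-- SimChain true relates e to e' when a chain of
-- Sim-steps through well-typed terms leads from e to e'; SimChain false
-- uses converse Sim-steps.  Both are reflexive and transitive by
-- construction, and compatible because Sim is closed under constructors.

data Oriented {A : Set} (R : A → A → Set) : Bool → A → A → Set where
  forth : ∀ {x y} → R x y → Oriented R true x y
  back  : ∀ {x y} → R y x → Oriented R false x y

oriented-map : ∀ {b} {A B : Set} {R : A → A → Set} {S : B → B → Set} (f : A → B) →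
               (∀ {x y} → R x y → S (f x) (f y)) → ∀ {x y} → Oriented R b x y → Oriented S b (f x) (f y)
oriented-map f h (forth q) = forth (h q)
oriented-map f h (back q) = back (h q)

Stepping : ∀ {A : Set} → (A → A → Set) → (A → Set) → A → A → Set
Stepping R P x y = R x y × P y

mapChain : ∀ {b} {A B : Set} {R : A → A → Set} {S : B → B → Set} {P : A → Set} {Q : B → Set} (f : A → B) →
           (∀ {x y} → R x y → S (f x) (f y)) → (∀ {x} → P x → Q (f x)) →
           ∀ {x y} → Star (Stepping (Oriented R b) P) x y → Star (Stepping (Oriented S b) Q) (f x) (f y)
mapChain f h hP = gmap f (λ { (q , p) → oriented-map f h q , hP p })

chain-end : ∀ {A : Set} {R : A → A → Set} {P : A → Set} {x y} → P x → Star (Stepping R P) x y → P y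
chain-end p ε = p
chain-end p ((_ , p') ◅ c) = chain-end p' c

Chain : Bool → ∀ {d m} → Ctx d m → Ty d → Tm d m → Tm d m → Set
Chain b Γ τ = Star (Stepping (Oriented Sim b) (λ e → Γ ⊢ e ∶ τ))

VChain : Bool → ∀ {d m} → Ctx d m → Ty d → Val d m → Val d m → Set
VChain b Γ τ = Star (Stepping (Oriented SimV b) (λ v → Γ ⊢v v ∶ τ))

BChain : Bool → ∀ {d m} → Ctx d m → Ty d → List (Ty (suc d)) → Ty d → List (Tm d (suc m)) → List (Tm d (suc m)) → Set
BChain b Γ r τs σ = Star (Stepping (Oriented SimBs b) (λ bs → ⊢Branches Γ r τs bs σ))

SimChain : Bool → TRel
SimChain b d m Γ e e' τ = (Γ ⊢ e ∶ τ) × Chain b Γ τ e e'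

valTy : ∀ {d m} {Γ : Ctx d m} {v τ} → Γ ⊢ val v ∶ τ → Γ ⊢v v ∶ τ
valTy (⊢val t) = t

-- Against the orientation, a chain ending in a value passes only through
-- values (a term related to a value on the left is a value).
chain-to-value : ∀ {d m} {Γ : Ctx d m} {τ y v'} → Chain false Γ τ y (val v') → Σ (Val d m) λ w → y ≡ val w
chain-to-value ε = _ , refl
chain-to-value ((back q , t) ◅ r) with chain-to-value r
... | w , refl with Sim-val q
... | _ , eq , _ = _ , eq

toVChain : ∀ {b d m} {Γ : Ctx d m} {τ v v'} → Chain b Γ τ (val v) (val v') → VChain b Γ τ v v'
toVChain ε = ε
toVChain ((forth q , t) ◅ r) with Sim-val q
... | w , refl , a = (forth a , valTy t) ◅ toVChain r
toVChain ((back q , t) ◅ r) with chain-to-value r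
... | w , refl with Sim-val q
... | _ , refl , a = (back a , valTy t) ◅ toVChain r

-- Related branch lists give a chain of branch lists, changing one branch
-- at a time.
branch-chain : ∀ {b d m} {Γ : Ctx d m} {r τs bs bs' σ} → RelBranches (SimChain b) Γ r τs bs bs' σ →
               ⊢Branches Γ r τs bs σ × BChain b Γ r τs σ bs bs'
branch-chain [] = [] , ε
branch-chain ((te , c) ∷ rest) with branch-chain rest
... | tl , cl = (te ∷ tl) ,
      (mapChain (_∷ _) (λ q → q ∷ reflSimBs _) (λ t → t ∷ tl) c ◅◅
       mapChain (_ ∷_) (λ q → reflSim _ ∷ q) (λ t → chain-end te c ∷ t) cl)

-- Compatibility for the constructors with two or more related parts: the
-- parts are replaced one after the other, the others staying fixed.
pair-chain : ∀ {b d m} {Γ : Ctx d m} {v v' w w' a c} → SimChain b d m Γ (val v) (val v') a → SimChain b d m Γ (val w) (val w') c →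
             SimChain b d m Γ (val (pair v w)) (val (pair v' w')) (a ⊗ c)
pair-chain {v' = v'} {w = w} (tv , cv) (tw , cw) =
  ⊢val (⊢pair (valTy tv) (valTy tw)) ,
  (mapChain (λ x → val (pair x w)) (λ q → s-val (s-pair q (reflSimV w))) (λ x → ⊢val (⊢pair x (valTy tw))) (toVChain cv) ◅◅
   mapChain (λ x → val (pair v' x)) (λ q → s-val (s-pair (reflSimV v') q)) (λ x → ⊢val (⊢pair (valTy (chain-end tv cv)) x)) (toVChain cw))

app-chain : ∀ {b d m} {Γ : Ctx d m} {v v' e e' a c} → SimChain b d m Γ (val v) (val v') (a ⇒ c) → SimChain b d m Γ e e' a →
            SimChain b d m Γ (app v e) (app v' e') c
app-chain {v' = v'} {e = e} (tv , cv) (te , ce) =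
  ⊢app (valTy tv) te ,
  (mapChain (λ x → app x e) (λ q → s-app q (reflSim e)) (λ x → ⊢app x te) (toVChain cv) ◅◅
   mapChain (app v') (s-app (reflSimV v')) (⊢app (valTy (chain-end tv cv))) ce)

case-chain : ∀ {b d m} {Γ : Ctx d m} {v v' τ τs bs bs' σ} → SimChain b d m Γ (val v) (val v') (μ τ τs) →
             RelBranches (SimChain b) Γ (μ τ τs) (τ ∷ τs) bs bs' σ → SimChain b d m Γ (case v bs) (case v' bs') σ
case-chain {v' = v'} {bs = bs} (tv , cv) rb with branch-chain rb
... | tbs , cb = ⊢case (valTy tv) tbs ,
      (mapChain (λ x → case x bs) (λ q → s-case q (reflSimBs bs)) (λ x → ⊢case x tbs) (toVChain cv) ◅◅
       mapChain (case v') (s-case (reflSimV v')) (⊢case (valTy (chain-end tv cv))) cb)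

compatible : ∀ b → Compatible (SimChain b)
compatible b = record
  { c-var = λ i → ⊢val (⊢var i) , ε
  ; c-unit = ⊢val ⊢unit , ε
  ; c-? = ⊢? , ε
  ; c-pair = pair-chain
  ; c-lam = λ { (t , c) → ⊢val (⊢lam t) , mapChain (val ∘ lam) (s-val ∘ s-lam) (⊢val ∘ ⊢lam) c }
  ; c-inj = λ { n (t , c) → ⊢val (⊢inj n (valTy t)) ,
                mapChain (λ x → val (inj _ x)) (s-val ∘ s-inj _) (⊢val ∘ ⊢inj n) (toVChain c) }
  ; c-tlam = λ { (t , c) → ⊢val (⊢tlam t) , mapChain (val ∘ tlam) (s-val ∘ s-tlam) (⊢val ∘ ⊢tlam) c }
  ; c-projL = λ { (t , c) → ⊢projL (valTy t) , mapChain projL s-projL ⊢projL (toVChain c) }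
  ; c-projR = λ { (t , c) → ⊢projR (valTy t) , mapChain projR s-projR ⊢projR (toVChain c) }
  ; c-app = app-chain
  ; c-case = case-chain
  ; c-tapp = λ { (t , c) σ → ⊢tapp (valTy t) σ ,
                 mapChain (λ x → tapp x σ) (λ q → s-tapp q σ) (λ x → ⊢tapp x σ) (toVChain c) }
  }

precongruence : ∀ b → Precongruence (SimChain b)
precongruence b = record
  { typed = λ { (t , c) → t , chain-end t c }
  ; reflexive = λ t → t , ε
  ; transitive = λ { (t , c) (_ , c') → t , (c ◅◅ c') }
  ; compatible = compatible b
  }

chain-adequate : ∀ b (P : CTm → Set) → (∀ {x y τ} → []ᵥ ⊢ x ∶ τ → []ᵥ ⊢ y ∶ τ → Oriented Sim b x y → P x → P y) →
                 ∀ {x y τ} → SimChain b 0 0 []ᵥ x y τ → P x → P y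
chain-adequate b P preserves (t , c) = go t c
  where
  go : ∀ {x y τ} → []ᵥ ⊢ x ∶ τ → Chain b []ᵥ τ x y → P x → P y
  go t ε h = h
  go t ((q , t') ◅ r) h = go t' r (preserves t t' q h)

-- fix[τ][τ] f is the first state of its run, so Sim relates it to id.
-- Hence SimChain true relates fix[τ][τ] f to id and SimChain false relates
-- id to fix[τ][τ] f; these precongruences are may- and must-adequate.
mainTheorem13 : []ᵥ ⊢ fixττf ≅ctx idTm ∶ (τ₀ ⇒ τ₀)
mainTheorem13 =
  (SimChain true  , precongruence true  , chain-adequate true _↓ (λ { t _ (forth q) → may-forth t q ∘ proj₂ }) , fix≲id) ,
  (SimChain false , precongruence false , chain-adequate false _↓ (λ { _ t (back q) → may-back t q }) , id≳fix) ,
  (SimChain true  , precongruence true  , chain-adequate true _⇓ (λ { t _ (forth q) → must-forth t q }) , fix≲id) ,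
  (SimChain false , precongruence false , chain-adequate false _⇓ (λ { _ t (back q) → must-back t q }) , id≳fix)
  where
  fix≲id : SimChain true 0 0 []ᵥ fixττf idTm (τ₀ ⇒ τ₀)
  fix≲id = tFix , (forth s-run₀ , tId) ◅ ε
  id≳fix : SimChain false 0 0 []ᵥ idTm fixττf (τ₀ ⇒ τ₀)
  id≳fix = tId , (back s-run₀ , tFix) ◅ ε
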